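{- We have $$\begin{aligned} \langle z^n\rangle& \left(\frac {\alpha z} {1-yz}\right)^{f-t} \frac {1-\left(\frac {\alpha z^2M(z)} {1-yz}\right)^{t}} {1+xzM(z)} \frac {\alpha \left(zM(z)\right)^2} {1-\alpha z^2M^2(z)}\\ &=\sum_{\substack{c,d,e\ge0\\ c+d+2e-f+t=n}} x^cy^d\alpha^{e} \left(\frac {(n-1)!\,(n-d-f+t-1)!} {(n-d-e)\,c!\,d!\,(n-d-1)!\,(e-f+t-1)!^2} -\frac {(n-1)!\,(n-d-f-1)!} {(n-d-e)\,c!\,d!\,(n-d-1)!\,(e-f-1)!\,(e-f+t-1)!}\right). \end{aligned}$$
   Context: $M(z)$ is the formal power series in $z$ (with coefficients polynomials in $x,y,\alpha$) satisfying $M(z)=1+(x+y)zM(z)+\alpha z^2M^2(z)$ (generating function of two-coloured Motzkin paths from $(0,0)$ ending on the $x$-axis). $\langle z^n\rangle$ denotes coefficient extraction; $n,f$ are positive integers and $t$ a non-negative integer (the lemma is applied with $t<f$). Any expression containing $m!$ with $m<0$ in the denominator is interpreted as $0$. -}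

module Defs where

open import Data.Nat as ℕ using (ℕ; zero; suc; _∸_; _!)
open import Data.Nat.Properties using (_!≢0)
open import Relation.Nullary using (yes; no)
open import Relation.Binary.PropositionalEquality using (_≡_)
open import Data.Integer as ℤ using (ℤ; +_; -[1+_])
open import Data.Rational using (ℚ; 0ℚ; 1ℚ; _+_; _*_; -_; _-_; _/_)
open import Data.Vec using (Vec; []; _∷_; head)
import Data.Vec as Vec

-- Coefficient ring: formal power series in x, y, α over ℚ,
-- represented by their coefficient functions:  p a b c = ⟨x^a y^b α^c⟩ p.
-- (Every object below is actually a polynomial in x,y,α.)

Poly : Set
Poly = ℕ → ℕ → ℕ → ℚ

sumTo : ℕ → (ℕ → ℚ) → ℚ
sumTo zero    g = g 0
sumTo (suc n) g = sumTo n g + g (suc n)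

0P : Poly
0P _ _ _ = 0ℚ

constP : ℚ → Poly
constP q zero zero zero = q
constP q _    _    _    = 0ℚ

1P : Poly
1P = constP 1ℚ

xP : Poly
xP 1 0 0 = 1ℚ
xP _ _ _ = 0ℚ

yP : Poly
yP 0 1 0 = 1ℚ
yP _ _ _ = 0ℚ

αP : Poly
αP 0 0 1 = 1ℚ
αP _ _ _ = 0ℚ

_+P_ : Poly → Poly → Poly
(p +P q) a b c = p a b c + q a b c

-P_ : Poly → Poly
(-P p) a b c = - p a b c

_*P_ : Poly → Poly → Poly
(p *P q) a b c =
  sumTo a λ i → sumTo b λ j → sumTo c λ k →
    p i j k * q (a ∸ i) (b ∸ j) (c ∸ k)

-- Formal power series in z with coefficients in Poly:
-- S n = ⟨z^n⟩ S.

Series : Set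
Series = ℕ → Poly

coeff : ℕ → Series → Poly
coeff n S = S n

sumP : ℕ → (ℕ → Poly) → Poly
sumP zero    g = g 0
sumP (suc n) g = sumP n g +P g (suc n)

constS : Poly → Series
constS p zero    = p
constS p (suc _) = 0P

1S : Series
1S = constS 1P

zS : Series
zS 1 = 1P
zS _ = 0P

_+S_ : Series → Series → Series
(A +S B) n = A n +P B n

-S_ : Series → Series
(-S A) n = -P (A n)

_-S_ : Series → Series → Series
A -S B = A +S (-S B)

_*S_ : Series → Series → Series
(A *S B) n = sumP n λ k → A k *P B (n ∸ k)

⟦_⟧ : Poly → Series
⟦ p ⟧ = constS p

_^S_ : Series → ℕ → Series
A ^S zero  = 1S
A ^S suc k = A *S (A ^S k)

nth : ∀ {m} → Vec Poly m → ℕ → Poly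
nth []       _       = 0P
nth (p ∷ ps) zero    = p
nth (p ∷ ps) (suc k) = nth ps k

-- Multiplicative inverse of a series A whose constant term is 1
-- (only applied to such series): g₀ = 1, gₙ = - Σ_{k=1}^{n} Aₖ g_{n-k}.
-- invPrefix A n = [gₙ , g_{n-1} , … , g₀].
invPrefix : Series → (n : ℕ) → Vec Poly (suc n)
invPrefix A zero    = 1P ∷ []
invPrefix A (suc n) =
  (-P (sumP n λ k → A (suc k) *P nth prev k)) ∷ prev
  where
  prev : Vec Poly (suc n)
  prev = invPrefix A n

inv : Series → Series
inv A n = head (invPrefix A n)

-- 1 / m!   (interpreted as 0 when m < 0)
invFact : ℤ → ℚ
invFact (+ m)    = _/_ (+ 1) (m !) {{m !≢0}}
invFact -[1+ _ ] = 0ℚ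

-- m! in a numerator; never evaluated at m < 0 on a nonzero term
fact : ℤ → ℚ
fact (+ m)    = + (m !) / 1
fact -[1+ _ ] = 0ℚ

-- 1 / m  (never evaluated at m = 0 on a nonzero term)
recip : ℤ → ℚ
recip (+ zero)  = 0ℚ
recip (+ suc m) = + 1 / suc m
recip -[1+ m ]  = ℤ.-[1+ 0 ] / suc m

IsMotzkin : Series → Set
IsMotzkin M =
  ∀ n a b c →
  M n a b c ≡ (1S +S ((⟦ xP +P yP ⟧ *S (zS *S M))
                 +S (⟦ αP ⟧ *S ((zS ^S 2) *S (M *S M))))) n a b c

lhsSeries : Series → ℕ → ℕ → Series
lhsSeries M f t =
  ((((⟦ αP ⟧ *S zS) *S inv (1S -S (⟦ yP ⟧ *S zS))) ^S (f ∸ t))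
   *S ((1S -S (((⟦ αP ⟧ *S ((zS ^S 2) *S M)) *S inv (1S -S (⟦ yP ⟧ *S zS))) ^S t))
   *S inv (1S +S (⟦ xP ⟧ *S (zS *S M)))))
  *S ((⟦ αP ⟧ *S ((zS *S M) ^S 2))
      *S inv (1S -S (⟦ αP ⟧ *S ((zS ^S 2) *S (M *S M)))))

bracket : ℕ → ℕ → ℕ → ℕ → ℕ → ℕ → ℚ
bracket n f t c d e =
    (fact (N ⊖ one) * fact (N ⊖ D ⊖ F ⊕ T ⊖ one)
      * recip (N ⊖ D ⊖ E) * invFact C * invFact D * invFact (N ⊖ D ⊖ one)
      * invFact (E ⊖ F ⊕ T ⊖ one) * invFact (E ⊖ F ⊕ T ⊖ one))
  - (fact (N ⊖ one) * fact (N ⊖ D ⊖ F ⊖ one)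
      * recip (N ⊖ D ⊖ E) * invFact C * invFact D * invFact (N ⊖ D ⊖ one)
      * invFact (E ⊖ F ⊖ one) * invFact (E ⊖ F ⊕ T ⊖ one))
  where
  infixl 6 _⊕_ _⊖_
  _⊕_ _⊖_ : ℤ → ℤ → ℤ
  _⊕_ = ℤ._+_
  _⊖_ = ℤ._-_
  N F T C D E one : ℤ
  one = + 1
  N = + n
  F = + f
  T = + t
  C = + c
  D = + d
  E = + e

rhsPoly : ℕ → ℕ → ℕ → Poly
rhsPoly n f t c d e with (c ℕ.+ d ℕ.+ 2 ℕ.* e ℕ.+ t) ℕ.≟ (n ℕ.+ f)
... | yes _ = bracket n f t c d e
... | no  _ = 0ℚ

{-# OPTIONS --safe #-}
module Submission where

open import Defs
open import Algebra.Bundles using (CommutativeRing)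
open import Algebra.Structures using (IsCommutativeRing)
import Algebra.Solver.CommutativeMonoid
open import Data.Empty using (⊥-elim)
open import Data.Fin.Base using (toℕ)
open import Data.Integer.Base as ℤ using (ℤ; +_; -[1+_])
import Data.Integer.Properties as ℤ
import Data.Integer.Tactic.RingSolver as ℤ-Solver
open import Data.Nat.Base as ℕ using (ℕ; zero; suc; _∸_; _≤_; _<_; z≤n; s≤s; _!)
import Data.Nat.Properties as ℕ
open import Data.Nat.Combinatorics using (_C_; nCk+nC[k+1]≡[n+1]C[k+1]; nCk≡n!/k![n-k]!; k![n∸k]!∣n!)
open import Data.Nat.DivMod using (m/n*n≡m)
open import Data.Nat.Induction using (<-rec)
open import Data.Nat.Tactic.RingSolver using (solve-∀)
open import Data.Product.Base using (_,_) renaming (_×_ to _∧_)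
open import Data.Rational.Base as ℚ using (ℚ; 0ℚ; 1ℚ)
import Data.Rational.Properties as ℚ
import Data.Rational.Unnormalised.Base as ℚᵘ
import Data.Rational.Unnormalised.Properties as ℚᵘ
open import Function.Base using (_∘_)
open import Relation.Binary.PropositionalEquality as ≡ using (_≡_; _≢_)
open import Relation.Nullary using (¬_; Dec; yes; no; contradiction)

-- With u = zM the Motzkin equation reads u = z Φ(u), where Φ(w) = 1 + (x + y) w + α w², and every factor
-- of the left-hand side is a series in u: with ψ(w) = 1 + x w + α w² one has z ψ(u) = u (1 - yz), so
-- αz/(1 - yz) = αu/ψ(u), αz²M/(1 - yz) = αu²/ψ(u), 1 + xzM = 1 + xu and αz²M² = αu². Lagrange inversion
-- [z^(n+1)] H(u) = [z^(n+1)] H(z) Φ(z)^n (1 - αz²) then writes the left-hand side as the difference of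
-- [z^(n+1)] α^(K+1) z^(K+T+2) Φ(z)^n / (ψ(z)^K (1 + xz)) for (K, T) = (f - t, 0) and (f, t). Expanding
-- Φ(z) = yz + ψ(z) and ψ(z) = αz² + (1 + xz) binomially, each coefficient of x^c y^d α^e is a single product
-- of three binomial coefficients, which is the factorial expression of the statement.

module FiniteSums {c ℓ} (R : CommutativeRing c ℓ) where

  open CommutativeRing R
  open import Relation.Binary.Reasoning.Setoid setoid
  open import Algebra.Properties.Semiring.Mult semiring public
    using (_×_; ×-congʳ; ×-homo-+; ×-comm-*; ×-assoc-*; ×-assocˡ)
  open import Algebra.Properties.CommutativeSemiring.Exp commutativeSemiring public using (_^_)
  import Algebra.Properties.CommutativeSemiring.Binomial commutativeSemiring as Binomial
  open import Algebra.Properties.Semiring.Sum semiring using (sum)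
  open import Algebra.Properties.CommutativeSemigroup +-commutativeSemigroup
    using () renaming (interchange to +-interchange)

  -- Σ n g = g 0 + g 1 + ⋯ + g n, associated to the left like Defs.sumTo.
  Σ : ℕ → (ℕ → Carrier) → Carrier
  Σ zero    g = g 0
  Σ (suc n) g = Σ n g + g (suc n)

  Σ-cong≤ : ∀ n {g h : ℕ → Carrier} → (∀ i → i ≤ n → g i ≈ h i) → Σ n g ≈ Σ n h
  Σ-cong≤ zero    g≈h = g≈h 0 z≤n
  Σ-cong≤ (suc n) g≈h = +-cong (Σ-cong≤ n (λ i i≤n → g≈h i (ℕ.m≤n⇒m≤1+n i≤n))) (g≈h (suc n) ℕ.≤-refl)

  Σ-cong : ∀ n {g h : ℕ → Carrier} → (∀ i → g i ≈ h i) → Σ n g ≈ Σ n h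
  Σ-cong n g≈h = Σ-cong≤ n (λ i _ → g≈h i)

  Σ-distrib-+ : ∀ n g h → Σ n (λ i → g i + h i) ≈ Σ n g + Σ n h
  Σ-distrib-+ zero    g h = refl
  Σ-distrib-+ (suc n) g h = trans (+-congʳ (Σ-distrib-+ n g h)) (+-interchange _ _ _ _)

  *-distribˡ-Σ : ∀ n a g → a * Σ n g ≈ Σ n (λ i → a * g i)
  *-distribˡ-Σ zero    a g = refl
  *-distribˡ-Σ (suc n) a g = trans (distribˡ a _ _) (+-congʳ (*-distribˡ-Σ n a g))

  *-distribʳ-Σ : ∀ n a g → Σ n g * a ≈ Σ n (λ i → g i * a)
  *-distribʳ-Σ zero    a g = refl
  *-distribʳ-Σ (suc n) a g = trans (distribʳ a _ _) (+-congʳ (*-distribʳ-Σ n a g))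

  Σ-zero : ∀ n g → (∀ i → i ≤ n → g i ≈ 0#) → Σ n g ≈ 0#
  Σ-zero zero    g g≈0 = g≈0 0 z≤n
  Σ-zero (suc n) g g≈0 =
    trans (+-cong (Σ-zero n g (λ i i≤n → g≈0 i (ℕ.m≤n⇒m≤1+n i≤n))) (g≈0 (suc n) ℕ.≤-refl)) (+-identityʳ 0#)

  Σ-unfoldˡ : ∀ n g → Σ (suc n) g ≈ g 0 + Σ n (λ i → g (suc i))
  Σ-unfoldˡ zero    g = refl
  Σ-unfoldˡ (suc n) g = trans (+-congʳ (Σ-unfoldˡ n g)) (+-assoc _ _ _)

  Σ-reverse : ∀ n g → Σ n g ≈ Σ n (λ i → g (n ∸ i))
  Σ-reverse zero    g = refl
  Σ-reverse (suc n) g = begin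
    Σ n g + g (suc n)                     ≈⟨ +-comm _ _ ⟩
    g (suc n) + Σ n g                     ≈⟨ +-congˡ (Σ-reverse n g) ⟩
    g (suc n) + Σ n (λ i → g (n ∸ i))     ≈⟨ Σ-unfoldˡ n (λ i → g (suc n ∸ i)) ⟨
    Σ (suc n) (λ i → g (suc n ∸ i))       ∎

  Σ-comm : ∀ m n (F : ℕ → ℕ → Carrier) → Σ m (λ i → Σ n (F i)) ≈ Σ n (λ j → Σ m (λ i → F i j))
  Σ-comm zero    n F = refl
  Σ-comm (suc m) n F = trans (+-congʳ (Σ-comm m n F)) (sym (Σ-distrib-+ n _ _))

  Σ-single : ∀ n j g → j ≤ n → (∀ i → i ≤ n → i ≢ j → g i ≈ 0#) → Σ n g ≈ g j
  Σ-single zero    zero g _ _ = refl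
  Σ-single (suc n) j g j≤ g≈0 with j ℕ.≟ suc n
  ... | yes ≡.refl =
    trans (+-congʳ (Σ-zero n g (λ i i≤n → g≈0 i (ℕ.m≤n⇒m≤1+n i≤n) (ℕ.<⇒≢ (s≤s i≤n))))) (+-identityˡ _)
  ... | no  j≢ = trans (+-congˡ (g≈0 (suc n) ℕ.≤-refl (j≢ ∘ ≡.sym))) (trans (+-identityʳ _)
      (Σ-single n j g (ℕ.≤-pred (ℕ.≤∧≢⇒< j≤ j≢)) (λ i i≤n → g≈0 i (ℕ.m≤n⇒m≤1+n i≤n))))

  Σ-triangle : ∀ n (F : ℕ → ℕ → Carrier) → Σ n (λ i → Σ (n ∸ i) (F i)) ≈ Σ n (λ m → Σ m (λ i → F i (m ∸ i)))
  Σ-triangle zero    F = refl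
  Σ-triangle (suc n) F = begin
    Σ n (λ i → Σ (suc n ∸ i) (F i)) + Σ (n ∸ n) (F (suc n))
      ≈⟨ +-cong (Σ-cong≤ n split) (reflexive (≡.cong (λ k → Σ k (F (suc n))) (ℕ.n∸n≡0 n))) ⟩
    Σ n (λ i → Σ (n ∸ i) (F i) + F i (suc n ∸ i)) + F (suc n) 0
      ≈⟨ +-congʳ (Σ-distrib-+ n _ _) ⟩
    (Σ n (λ i → Σ (n ∸ i) (F i)) + Σ n (λ i → F i (suc n ∸ i))) + F (suc n) 0
      ≈⟨ +-assoc _ _ _ ⟩
    Σ n (λ i → Σ (n ∸ i) (F i)) + (Σ n (λ i → F i (suc n ∸ i)) + F (suc n) 0)
      ≈⟨ +-cong (Σ-triangle n F) (+-congˡ (reflexive (≡.cong (F (suc n)) (≡.sym (ℕ.n∸n≡0 n))))) ⟩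
    Σ n (λ m → Σ m (λ i → F i (m ∸ i))) + Σ (suc n) (λ i → F i (suc n ∸ i)) ∎
    where
    split : ∀ i → i ≤ n → Σ (suc n ∸ i) (F i) ≈ Σ (n ∸ i) (F i) + F i (suc n ∸ i)
    split i i≤n rewrite ℕ.+-∸-assoc 1 i≤n = refl

  ×-distrib-Σ : ∀ q n g → q × Σ n g ≈ Σ n (λ i → q × g i)
  ×-distrib-Σ q zero    g = refl
  ×-distrib-Σ q (suc n) g = trans (×-distrib-+ (Σ n g) (g (suc n)) q) (+-congʳ (×-distrib-Σ q n g))
    where open import Algebra.Properties.CommutativeMonoid.Mult +-commutativeMonoid using (×-distrib-+)

  Σ≈sum : ∀ n g → Σ n g ≈ sum {suc n} (λ k → g (toℕ k))
  Σ≈sum zero    g = sym (+-identityʳ (g 0))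
  Σ≈sum (suc n) g = trans (Σ-unfoldˡ n g) (+-congˡ (Σ≈sum n (λ i → g (suc i))))

  binomial-theorem : ∀ n a b → (a + b) ^ n ≈ Σ n (λ k → (n C k) × (a ^ k * b ^ (n ∸ k)))
  binomial-theorem n a b = trans (Binomial.theorem n a b) (sym (Σ≈sum n _))

  ×-zeroʳ : ∀ q → q × 0# ≈ 0#
  ×-zeroʳ zero    = refl
  ×-zeroʳ (suc q) = trans (+-identityˡ _) (×-zeroʳ q)

  when : ∀ {p} {P : Set p} → Dec P → Carrier → Carrier
  when (yes _) a = a
  when (no  _) _ = 0#

  when-cong : ∀ {p} {P : Set p} (P? : Dec P) {a b} → (P → a ≈ b) → when P? a ≈ when P? b
  when-cong (yes p) a≈b = a≈b p
  when-cong (no  _) _   = refl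

  when-zero : ∀ {p} {P : Set p} (P? : Dec P) {a} → (P → a ≈ 0#) → when P? a ≈ 0#
  when-zero (yes p) a≈0 = a≈0 p
  when-zero (no  _) _   = refl

  when-yes : ∀ {p} {P : Set p} (P? : Dec P) {a} → P → when P? a ≈ a
  when-yes (yes _) _ = refl
  when-yes (no ¬p) p = contradiction p ¬p

  *-distribˡ-when : ∀ {p} {P : Set p} (P? : Dec P) a b → a * when P? b ≈ when P? (a * b)
  *-distribˡ-when (yes _) a b = refl
  *-distribˡ-when (no  _) a b = zeroʳ a

  ×-distrib-when : ∀ {p} {P : Set p} (P? : Dec P) q b → q × when P? b ≈ when P? (q × b)
  ×-distrib-when (yes _) q b = refl
  ×-distrib-when (no  _) q b = ×-zeroʳ q

module PowerSeries {c ℓ} (R : CommutativeRing c ℓ) where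

  open CommutativeRing R
  open FiniteSums R
  open import Relation.Binary.Reasoning.MultiSetoid
  open import Algebra.Properties.CommutativeSemigroup +-commutativeSemigroup
    using () renaming (interchange to +-interchange)
  open import Algebra.Properties.CommutativeSemigroup *-commutativeSemigroup using (x∙yz≈y∙xz)
  open import Algebra.Properties.Ring ring using (-0#≈0#)

  FPS : Set c
  FPS = ℕ → Carrier

  infix  4 _≋_
  infixl 6 _⊕_
  infixl 7 _⊛_
  infix  8 ⊝_

  _≋_ : FPS → FPS → Set ℓ
  f ≋ g = ∀ n → f n ≈ g n

  _⊕_ : FPS → FPS → FPS
  (f ⊕ g) n = f n + g n

  ⊝_ : FPS → FPS
  (⊝ f) n = - f n

  _⊛_ : FPS → FPS → FPS
  (f ⊛ g) n = Σ n (λ k → f k * g (n ∸ k))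

  const : Carrier → FPS
  const a zero    = a
  const a (suc _) = 0#

  𝟘 𝟙 X : FPS
  𝟘 _ = 0#
  𝟙 = const 1#
  X zero          = 0#
  X (suc zero)    = 1#
  X (suc (suc _)) = 0#

  tail : FPS → FPS
  tail f n = f (suc n)

  quadratic : Carrier → Carrier → FPS → FPS
  quadratic a b V = 𝟙 ⊕ const a ⊛ V ⊕ const b ⊛ (V ⊛ V)

  ⊛-cong : ∀ {f f′ g g′} → f ≋ f′ → g ≋ g′ → f ⊛ g ≋ f′ ⊛ g′
  ⊛-cong f≋ g≋ n = Σ-cong n (λ k → *-cong (f≋ k) (g≋ (n ∸ k)))

  ⊛-comm : ∀ f g → f ⊛ g ≋ g ⊛ f
  ⊛-comm f g n = trans (Σ-reverse n _) (Σ-cong≤ n (λ i i≤n →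
    trans (*-comm _ _) (*-congʳ (reflexive (≡.cong g (ℕ.m∸[m∸n]≡n i≤n))))))

  ⊛-identityˡ : ∀ f → 𝟙 ⊛ f ≋ f
  ⊛-identityˡ f zero    = *-identityˡ _
  ⊛-identityˡ f (suc n) = begin⟨ setoid ⟩
    Σ (suc n) (λ k → 𝟙 k * f (suc n ∸ k))          ≈⟨ Σ-unfoldˡ n _ ⟩
    1# * f (suc n) + Σ n (λ i → 0# * f (n ∸ i))    ≈⟨ +-cong (*-identityˡ _) (Σ-zero n _ (λ i _ → zeroˡ _)) ⟩
    f (suc n) + 0#                                 ≈⟨ +-identityʳ _ ⟩
    f (suc n)                                      ∎

  ⊛-distribˡ : ∀ f g h → f ⊛ (g ⊕ h) ≋ f ⊛ g ⊕ f ⊛ h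
  ⊛-distribˡ f g h n = trans (Σ-cong n (λ k → distribˡ _ _ _)) (Σ-distrib-+ n _ _)

  ⊛-assoc : ∀ f g h → (f ⊛ g) ⊛ h ≋ f ⊛ (g ⊛ h)
  ⊛-assoc f g h n = begin⟨ setoid ⟩
    Σ n (λ m → Σ m (λ i → f i * g (m ∸ i)) * h (n ∸ m))
      ≈⟨ Σ-cong n (λ m → *-distribʳ-Σ m _ _) ⟩
    Σ n (λ m → Σ m (λ i → f i * g (m ∸ i) * h (n ∸ m)))
      ≈⟨ Σ-cong n (λ m → Σ-cong≤ m (λ i i≤m → trans (*-assoc _ _ _) (*-congˡ (*-congˡ (reflexive
           (≡.cong h (≡.trans (≡.cong (n ∸_) (≡.sym (ℕ.m+[n∸m]≡n i≤m))) (≡.sym (ℕ.∸-+-assoc n i (m ∸ i)))))))))) ⟩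
    Σ n (λ m → Σ m (λ i → f i * (g (m ∸ i) * h (n ∸ i ∸ (m ∸ i)))))
      ≈⟨ Σ-triangle n (λ i j → f i * (g j * h (n ∸ i ∸ j))) ⟨
    Σ n (λ i → Σ (n ∸ i) (λ j → f i * (g j * h (n ∸ i ∸ j))))
      ≈⟨ Σ-cong n (λ i → *-distribˡ-Σ (n ∸ i) _ _) ⟨
    Σ n (λ i → f i * Σ (n ∸ i) (λ j → g j * h (n ∸ i ∸ j))) ∎

  opaque
    FPS-isCommutativeRing : IsCommutativeRing _≋_ _⊕_ _⊛_ ⊝_ 𝟘 𝟙
    FPS-isCommutativeRing = record
      { isRing = record
        { +-isAbelianGroup = record
          { isGroup = record
            { isMonoid = record
              { isSemigroup = record
                { isMagma = record
                  { isEquivalence = record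
                    { refl = λ _ → refl ; sym = λ e n → sym (e n) ; trans = λ e e′ n → trans (e n) (e′ n) }
                  ; ∙-cong = λ e e′ n → +-cong (e n) (e′ n) }
                ; assoc = λ _ _ _ _ → +-assoc _ _ _ }
              ; identity = (λ _ _ → +-identityˡ _) , (λ _ _ → +-identityʳ _) }
            ; inverse = (λ _ _ → -‿inverseˡ _) , (λ _ _ → -‿inverseʳ _)
            ; ⁻¹-cong = λ e n → -‿cong (e n) }
          ; comm = λ _ _ _ → +-comm _ _ }
        ; *-cong = ⊛-cong
        ; *-assoc = ⊛-assoc
        ; *-identity = ⊛-identityˡ , (λ f n → trans (⊛-comm f 𝟙 n) (⊛-identityˡ f n))
        ; distrib = ⊛-distribˡ , (λ f g h n → trans (⊛-comm (g ⊕ h) f n)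
                       (trans (⊛-distribˡ f g h n) (+-cong (⊛-comm f g n) (⊛-comm f h n))))
        }
      ; *-comm = ⊛-comm
      }

  FPS-commutativeRing : CommutativeRing c ℓ
  FPS-commutativeRing = record { isCommutativeRing = FPS-isCommutativeRing }

  module FPS where
    open CommutativeRing FPS-commutativeRing public
    open import Algebra.Properties.CommutativeSemigroup
      (CommutativeRing.*-commutativeSemigroup FPS-commutativeRing) public using (x∙yz≈y∙xz)
    open import Algebra.Properties.AbelianGroup
      (CommutativeRing.+-abelianGroup FPS-commutativeRing) public using (inverseʳ-unique)
  open FiniteSums FPS-commutativeRing public
    using () renaming (Σ to Σˢ; _^_ to _^ˢ_; _×_ to _×ˢ_; binomial-theorem to binomial-theoremˢ;
                       *-distribˡ-Σ to ⊛-distribˡ-Σˢ; *-distribʳ-Σ to ⊛-distribʳ-Σˢ; ×-assoc-* to ×ˢ-assoc-⊛;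
                       ×-comm-* to ×ˢ-comm-⊛; ×-congʳ to ×ˢ-congʳ)
  open import Algebra.Properties.CommutativeSemiring.Exp FPS.commutativeSemiring public
    using () renaming (^-congˡ to ^ˢ-congˡ; ^-homo-* to ^ˢ-homo-*; ^-distrib-* to ^ˢ-distrib-*; ^-assocʳ to ^ˢ-assocʳ)
  open import Algebra.Properties.Ring FPS.ring public
    using () renaming (-‿distribˡ-* to ⊝-distribˡ-⊛; -‿distribʳ-* to ⊝-distribʳ-⊛)
  module ⊛-Solver = Algebra.Solver.CommutativeMonoid FPS.*-commutativeMonoid
  module ⊕-Solver = Algebra.Solver.CommutativeMonoid FPS.+-commutativeMonoid

  Σˢ-coeff : ∀ n F m → Σˢ n F m ≈ Σ n (λ i → F i m)
  Σˢ-coeff zero    F m = refl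
  Σˢ-coeff (suc n) F m = +-congʳ (Σˢ-coeff n F m)

  ×ˢ-coeff : ∀ q f n → (q ×ˢ f) n ≈ q × f n
  ×ˢ-coeff zero    f n = refl
  ×ˢ-coeff (suc q) f n = +-congˡ (×ˢ-coeff q f n)

  const-⊛ : ∀ a f n → (const a ⊛ f) n ≈ a * f n
  const-⊛ a f zero    = refl
  const-⊛ a f (suc n) = trans (Σ-unfoldˡ n _) (trans (+-congˡ (Σ-zero n _ (λ _ _ → zeroˡ _))) (+-identityʳ _))

  const-cong : ∀ {a b} → a ≈ b → const a ≋ const b
  const-cong a≈b zero    = a≈b
  const-cong a≈b (suc n) = refl

  const-+ : ∀ a b → const (a + b) ≋ const a ⊕ const b
  const-+ a b zero    = refl
  const-+ a b (suc n) = sym (+-identityʳ 0#)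

  const-* : ∀ a b → const a ⊛ const b ≋ const (a * b)
  const-* a b zero    = refl
  const-* a b (suc n) = trans (const-⊛ a (const b) (suc n)) (zeroʳ a)

  const-0 : const 0# ≋ 𝟘
  const-0 zero    = refl
  const-0 (suc n) = refl

  const-^ : ∀ a k → const a ^ˢ k ≋ const (a ^ k)
  const-^ a zero    = FPS.refl
  const-^ a (suc k) = FPS.trans (FPS.*-congˡ {const a} (const-^ a k)) (const-* a (a ^ k))

  X⊛-zero : ∀ f → (X ⊛ f) 0 ≈ 0#
  X⊛-zero f = zeroˡ _

  X⊛-suc : ∀ f n → (X ⊛ f) (suc n) ≈ f n
  X⊛-suc f n = trans (Σ-unfoldˡ n _) (trans (+-cong (zeroˡ _)
    (Σ-single n 0 _ z≤n (λ { zero _ 0≢0 → ⊥-elim (0≢0 ≡.refl) ; (suc i) _ _ → zeroˡ _ })))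
    (trans (+-identityˡ _) (*-identityˡ _)))

  X^⊛-+ : ∀ j f m → (X ^ˢ j ⊛ f) (j ℕ.+ m) ≈ f m
  X^⊛-+ zero    f m = ⊛-identityˡ f m
  X^⊛-+ (suc j) f m = trans (⊛-assoc X (X ^ˢ j) f (suc (j ℕ.+ m))) (trans (X⊛-suc (X ^ˢ j ⊛ f) (j ℕ.+ m)) (X^⊛-+ j f m))

  X^⊛-suc : ∀ j f m → (X ^ˢ suc j ⊛ f) (suc m) ≈ (X ^ˢ j ⊛ f) m
  X^⊛-suc j f m = trans (⊛-assoc X (X ^ˢ j) f (suc m)) (X⊛-suc (X ^ˢ j ⊛ f) m)

  X^⊛-≥ : ∀ j f m → j ≤ m → (X ^ˢ j ⊛ f) m ≈ f (m ∸ j)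
  X^⊛-≥ j f m j≤m = trans (reflexive (≡.cong (X ^ˢ j ⊛ f) (≡.sym (ℕ.m+[n∸m]≡n j≤m)))) (X^⊛-+ j f (m ∸ j))

  X^⊛-< : ∀ j f m → m < j → (X ^ˢ j ⊛ f) m ≈ 0#
  X^⊛-< (suc j) f zero    _         = trans (⊛-assoc X (X ^ˢ j) f 0) (X⊛-zero (X ^ˢ j ⊛ f))
  X^⊛-< (suc j) f (suc m) (s≤s m<j) = trans (X^⊛-suc j f m) (X^⊛-< j f m m<j)

  ×ˢ-const-X^-coeff : ∀ q a j f m → (q ×ˢ (const a ⊛ (X ^ˢ j ⊛ f))) m ≈ when (j ℕ.≤? m) (q × (a * f (m ∸ j)))
  ×ˢ-const-X^-coeff q a j f m =
    trans (×ˢ-coeff q _ m) (trans (×-congʳ q (const-⊛ a (X ^ˢ j ⊛ f) m)) (shift (j ℕ.≤? m)))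
    where
    shift : (j≤?m : Dec (j ≤ m)) → q × (a * (X ^ˢ j ⊛ f) m) ≈ when j≤?m (q × (a * f (m ∸ j)))
    shift (yes j≤m) = ×-congʳ q (*-congˡ (X^⊛-≥ j f m j≤m))
    shift (no  j≰m) = trans (×-congʳ q (trans (*-congˡ (X^⊛-< j f m (ℕ.≰⇒> j≰m))) (zeroʳ a))) (×-distrib-when (no j≰m) q 0#)

  X^⊛const-≡ : ∀ a s′ → (X ^ˢ a ⊛ const s′) a ≈ s′
  X^⊛const-≡ a s′ = trans (X^⊛-≥ a (const s′) a ℕ.≤-refl) (reflexive (≡.cong (const s′) (ℕ.n∸n≡0 a)))

  X^⊛const-≢ : ∀ a s′ b → a ≢ b → (X ^ˢ a ⊛ const s′) b ≈ 0#
  X^⊛const-≢ a s′ b a≢b with a ℕ.≤? b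
  ... | no  a≰b = X^⊛-< a (const s′) b (ℕ.≰⇒> a≰b)
  ... | yes a≤b = trans (X^⊛-≥ a (const s′) b a≤b) (const-suc (ℕ.+-∸-assoc 1 (ℕ.≤∧≢⇒< a≤b a≢b)))
    where
    const-suc : ∀ {k} → b ∸ a ≡ suc k → const s′ (b ∸ a) ≈ 0#
    const-suc eq rewrite eq = refl

  head-𝟙⊕ : ∀ f → f 0 ≈ 0# → (𝟙 ⊕ f) 0 ≈ 1#
  head-𝟙⊕ f f0 = trans (+-congˡ f0) (+-identityʳ 1#)

  head-𝟙⊕⊝ : ∀ f → f 0 ≈ 0# → (𝟙 ⊕ ⊝ f) 0 ≈ 1#
  head-𝟙⊕⊝ f f0 = head-𝟙⊕ (⊝ f) (trans (-‿cong f0) -0#≈0#)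

  head-⊛ˡ : ∀ f g → f 0 ≈ 0# → (f ⊛ g) 0 ≈ 0#
  head-⊛ˡ f g f0 = trans (*-congʳ f0) (zeroˡ _)

  head-⊛ʳ : ∀ f g → g 0 ≈ 0# → (f ⊛ g) 0 ≈ 0#
  head-⊛ʳ f g g0 = trans (*-congˡ g0) (zeroʳ _)

  recurrence⇒inverse : ∀ f g → f 0 ≈ 1# → g 0 ≈ 1# →
                       (∀ n → g (suc n) ≈ - Σ n (λ k → f (suc k) * g (n ∸ k))) → f ⊛ g ≋ 𝟙
  recurrence⇒inverse f g f0 g0 g-rec zero    = trans (*-cong f0 g0) (*-identityˡ _)
  recurrence⇒inverse f g f0 g0 g-rec (suc n) = begin⟨ setoid ⟩
    Σ (suc n) (λ k → f k * g (suc n ∸ k))                ≈⟨ Σ-unfoldˡ n _ ⟩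
    f 0 * g (suc n) + Σ n (λ k → f (suc k) * g (n ∸ k))  ≈⟨ +-congʳ (trans (*-cong f0 (g-rec n)) (*-identityˡ _)) ⟩
    - Σ n (λ k → f (suc k) * g (n ∸ k)) + Σ n (λ k → f (suc k) * g (n ∸ k)) ≈⟨ -‿inverseˡ _ ⟩
    0#                                                   ∎

  inverse-unique : ∀ f g h → f ⊛ g ≋ 𝟙 → f ⊛ h ≋ 𝟙 → g ≋ h
  inverse-unique f g h fg≋1 fh≋1 = begin⟨ FPS.setoid ⟩
    g             ≈⟨ FPS.*-identityʳ g ⟨
    g ⊛ 𝟙         ≈⟨ FPS.*-congˡ {g} fh≋1 ⟨
    g ⊛ (f ⊛ h)   ≈⟨ FPS.*-assoc g f h ⟨
    (g ⊛ f) ⊛ h   ≈⟨ FPS.*-congʳ {h} (FPS.trans (FPS.*-comm g f) fg≋1) ⟩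
    𝟙 ⊛ h         ≈⟨ FPS.*-identityˡ h ⟩
    h             ∎

  cancel-inverseʳ : ∀ a b f → a ⊛ b ≋ 𝟙 → (f ⊛ a) ⊛ b ≋ f
  cancel-inverseʳ a b f ab≋1 = FPS.trans (FPS.*-assoc f a b) (FPS.trans (FPS.*-congˡ {f} ab≋1) (FPS.*-identityʳ f))

  head-zero⇒*≈ : ∀ (u : FPS) {a b} → u 0 ≈ 0# → u 0 * a ≈ u 0 * b
  head-zero⇒*≈ u u0 = trans (*-congʳ u0) (trans (zeroˡ _) (sym (trans (*-congʳ u0) (zeroˡ _))))

  ⊛-congʳ-below : ∀ (u : FPS) → u 0 ≈ 0# → ∀ m {f g} → (∀ j → j < m → f j ≈ g j) → (u ⊛ f) m ≈ (u ⊛ g) m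
  ⊛-congʳ-below u u0 zero    _   = head-zero⇒*≈ u u0
  ⊛-congʳ-below u u0 (suc m) {f} {g} f≈g = begin⟨ setoid ⟩
    (u ⊛ f) (suc m)                                        ≈⟨ Σ-unfoldˡ m _ ⟩
    u 0 * f (suc m) + Σ m (λ i → u (suc i) * f (m ∸ i))    ≈⟨ +-cong (head-zero⇒*≈ u u0)
                                                                (Σ-cong m (λ i → *-congˡ (f≈g (m ∸ i) (s≤s (ℕ.m∸n≤m m i))))) ⟩
    u 0 * g (suc m) + Σ m (λ i → u (suc i) * g (m ∸ i))    ≈⟨ Σ-unfoldˡ m _ ⟨
    (u ⊛ g) (suc m)                                        ∎

  tail-⊛ : ∀ f g → tail (f ⊛ g) ≋ tail f ⊛ g ⊕ const (f 0) ⊛ tail g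
  tail-⊛ f g n = begin⟨ setoid ⟩
    Σ (suc n) (λ k → f k * g (suc n ∸ k))                  ≈⟨ Σ-unfoldˡ n _ ⟩
    f 0 * g (suc n) + Σ n (λ i → f (suc i) * g (n ∸ i))    ≈⟨ +-comm _ _ ⟩
    (tail f ⊛ g) n + f 0 * tail g n                        ≈⟨ +-congˡ (const-⊛ (f 0) (tail g) n) ⟨
    (tail f ⊛ g) n + (const (f 0) ⊛ tail g) n              ∎

  module Composition (u : FPS) (u0 : u 0 ≈ 0#) where

    -- horner N H = H₀ + u (H₁ + u (H₂ + ⋯ + u H_N)), correct up to z^N.
    horner : ℕ → FPS → FPS
    horner zero    H = const (H 0)
    horner (suc N) H = const (H 0) ⊕ u ⊛ horner N (tail H)

    comp : FPS → FPS
    comp H n = horner n H n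

    horner-cong : ∀ N {H H′} → (∀ i → i ≤ N → H i ≈ H′ i) → horner N H ≋ horner N H′
    horner-cong zero    H≈ = const-cong (H≈ 0 z≤n)
    horner-cong (suc N) H≈ m =
      +-cong (const-cong (H≈ 0 z≤n) m) (⊛-cong FPS.refl (horner-cong N (λ i i≤N → H≈ (suc i) (s≤s i≤N))) m)

    horner-suc : ∀ N H m → m ≤ N → horner (suc N) H m ≈ horner N H m
    horner-suc zero    H zero    z≤n = trans (+-congˡ (trans (*-congʳ u0) (zeroˡ _))) (+-identityʳ _)
    horner-suc (suc N) H m       m≤N = +-congˡ (⊛-congʳ-below u u0 m (λ j j<m →
      horner-suc N (tail H) j (ℕ.≤-pred (ℕ.≤-trans j<m m≤N))))

    horner-+ : ∀ N′ N H m → m ≤ N → horner (N′ ℕ.+ N) H m ≈ horner N H m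
    horner-+ zero     N H m m≤N = refl
    horner-+ (suc N′) N H m m≤N =
      trans (horner-suc (N′ ℕ.+ N) H m (ℕ.≤-trans m≤N (ℕ.m≤n+m N N′))) (horner-+ N′ N H m m≤N)

    horner≈comp : ∀ N H m → m ≤ N → horner N H m ≈ comp H m
    horner≈comp N H m m≤N = trans (reflexive (≡.cong (λ k → horner k H m) (≡.sym (ℕ.m∸n+n≡m m≤N))))
                                  (horner-+ (N ∸ m) m H m ℕ.≤-refl)

    comp-horner : ∀ H → comp H ≋ const (H 0) ⊕ u ⊛ comp (tail H)
    comp-horner H zero    = sym (trans (+-congˡ (trans (*-congʳ u0) (zeroˡ _))) (+-identityʳ _))
    comp-horner H (suc m) = +-congˡ (⊛-congʳ-below u u0 (suc m) (λ j j<m → horner≈comp m (tail H) j (ℕ.≤-pred j<m)))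

    comp-cong : ∀ {H H′} → H ≋ H′ → comp H ≋ comp H′
    comp-cong H≋ n = horner-cong n (λ i _ → H≋ i) n

    horner-⊕ : ∀ N H K → horner N (H ⊕ K) ≋ horner N H ⊕ horner N K
    horner-⊕ zero    H K = const-+ (H 0) (K 0)
    horner-⊕ (suc N) H K m = begin⟨ setoid ⟩
      const (H 0 + K 0) m + (u ⊛ horner N (tail H ⊕ tail K)) m
        ≈⟨ +-cong (const-+ (H 0) (K 0) m)
                  (trans (⊛-cong FPS.refl (horner-⊕ N (tail H) (tail K)) m) (⊛-distribˡ u (horner N (tail H)) (horner N (tail K)) m)) ⟩
      (const (H 0) m + const (K 0) m) + ((u ⊛ horner N (tail H)) m + (u ⊛ horner N (tail K)) m)
        ≈⟨ +-interchange _ _ _ _ ⟩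
      (const (H 0) m + (u ⊛ horner N (tail H)) m) + (const (K 0) m + (u ⊛ horner N (tail K)) m) ∎

    comp-⊕ : ∀ H K → comp (H ⊕ K) ≋ comp H ⊕ comp K
    comp-⊕ H K n = horner-⊕ n H K n

    comp-const : ∀ a → comp (const a) ≋ const a
    comp-const a zero    = refl
    comp-const a (suc n) = trans (+-congˡ (trans (⊛-cong FPS.refl (horner-𝟘 n) (suc n))
                                                  (Σ-zero (suc n) _ (λ _ _ → zeroʳ _)))) (+-identityʳ _)
      where
      horner-𝟘 : ∀ N → horner N 𝟘 ≋ 𝟘
      horner-𝟘 zero    = const-0
      horner-𝟘 (suc N) m = trans (+-cong (const-0 m) (trans (⊛-cong FPS.refl (horner-𝟘 N) m)
                                                          (Σ-zero m _ (λ _ _ → zeroʳ _)))) (+-identityʳ _)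

    comp-𝟙 : comp 𝟙 ≋ 𝟙
    comp-𝟙 = comp-const 1#

    comp-X : comp X ≋ u
    comp-X n = begin⟨ setoid ⟩
      comp X n                                ≈⟨ comp-horner X n ⟩
      const 0# n + (u ⊛ comp (tail X)) n      ≈⟨ +-cong (const-0 n) (⊛-cong FPS.refl (comp-cong tail-X≋𝟙) n) ⟩
      0# + (u ⊛ comp 𝟙) n                     ≈⟨ +-identityˡ _ ⟩
      (u ⊛ comp 𝟙) n                          ≈⟨ ⊛-cong {u} FPS.refl comp-𝟙 n ⟩
      (u ⊛ 𝟙) n                               ≈⟨ FPS.*-identityʳ u n ⟩
      u n                                     ∎
      where
      tail-X≋𝟙 : tail X ≋ 𝟙
      tail-X≋𝟙 zero    = refl
      tail-X≋𝟙 (suc n) = refl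

    horner-form-⊛ : ∀ a b f g → (const a ⊕ u ⊛ f) ⊛ (const b ⊕ u ⊛ g)
                              ≋ const (a * b) ⊕ u ⊛ (f ⊛ (const b ⊕ u ⊛ g) ⊕ const a ⊛ g)
    horner-form-⊛ a b f g = begin⟨ FPS.setoid ⟩
      (const a ⊕ u ⊛ f) ⊛ W                          ≈⟨ FPS.distribʳ W (const a) (u ⊛ f) ⟩
      const a ⊛ W ⊕ (u ⊛ f) ⊛ W                      ≈⟨ FPS.+-cong (FPS.distribˡ (const a) (const b) (u ⊛ g)) (FPS.*-assoc u f W) ⟩
      (const a ⊛ const b ⊕ const a ⊛ (u ⊛ g)) ⊕ u ⊛ (f ⊛ W)
        ≈⟨ FPS.+-congʳ (FPS.+-cong (const-* a b) (FPS.x∙yz≈y∙xz (const a) u g)) ⟩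
      (const (a * b) ⊕ u ⊛ (const a ⊛ g)) ⊕ u ⊛ (f ⊛ W) ≈⟨ FPS.+-assoc _ _ _ ⟩
      const (a * b) ⊕ (u ⊛ (const a ⊛ g) ⊕ u ⊛ (f ⊛ W)) ≈⟨ FPS.+-congˡ (FPS.distribˡ u (const a ⊛ g) (f ⊛ W)) ⟨
      const (a * b) ⊕ u ⊛ (const a ⊛ g ⊕ f ⊛ W)       ≈⟨ FPS.+-congˡ (FPS.*-congˡ {u} (FPS.+-comm (const a ⊛ g) (f ⊛ W))) ⟩
      const (a * b) ⊕ u ⊛ (f ⊛ W ⊕ const a ⊛ g)       ∎
      where
      W = const b ⊕ u ⊛ g

    -- By strong induction on the coefficient: the Horner recursion for H ⊛ K only involves lower coefficients.
    comp-⊛ : ∀ H K → comp (H ⊛ K) ≋ comp H ⊛ comp K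
    comp-⊛ H K m = <-rec (λ m → ∀ H K → comp (H ⊛ K) m ≈ (comp H ⊛ comp K) m) step m H K
      where
      step : ∀ m → (∀ {j} → j < m → ∀ H K → comp (H ⊛ K) j ≈ (comp H ⊛ comp K) j) →
             ∀ H K → comp (H ⊛ K) m ≈ (comp H ⊛ comp K) m
      step m IH H K = begin⟨ setoid ⟩
        comp (H ⊛ K) m                                      ≈⟨ comp-horner (H ⊛ K) m ⟩
        const (H 0 * K 0) m + (u ⊛ comp (tail (H ⊛ K))) m   ≈⟨ +-congˡ (⊛-congʳ-below u u0 m tail-step) ⟩
        (const (H 0 * K 0) ⊕ u ⊛ (comp (tail H) ⊛ (const (K 0) ⊕ u ⊛ comp (tail K)) ⊕ const (H 0) ⊛ comp (tail K))) m
          ≈⟨ horner-form-⊛ (H 0) (K 0) (comp (tail H)) (comp (tail K)) m ⟨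
        ((const (H 0) ⊕ u ⊛ comp (tail H)) ⊛ (const (K 0) ⊕ u ⊛ comp (tail K))) m
          ≈⟨ ⊛-cong (comp-horner H) (comp-horner K) m ⟨
        (comp H ⊛ comp K) m                                 ∎
        where
        tail-step : ∀ j → j < m → comp (tail (H ⊛ K)) j
                    ≈ (comp (tail H) ⊛ (const (K 0) ⊕ u ⊛ comp (tail K)) ⊕ const (H 0) ⊛ comp (tail K)) j
        tail-step j j<m = begin⟨ setoid ⟩
          comp (tail (H ⊛ K)) j                                     ≈⟨ comp-cong (tail-⊛ H K) j ⟩
          comp (tail H ⊛ K ⊕ const (H 0) ⊛ tail K) j                ≈⟨ comp-⊕ (tail H ⊛ K) (const (H 0) ⊛ tail K) j ⟩
          comp (tail H ⊛ K) j + comp (const (H 0) ⊛ tail K) j       ≈⟨ +-cong (IH j<m (tail H) K) (IH j<m (const (H 0)) (tail K)) ⟩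
          (comp (tail H) ⊛ comp K) j + (comp (const (H 0)) ⊛ comp (tail K)) j
            ≈⟨ +-cong (⊛-cong {comp (tail H)} FPS.refl (comp-horner K) j) (⊛-cong {g = comp (tail K)} (comp-const (H 0)) FPS.refl j) ⟩
          (comp (tail H) ⊛ (const (K 0) ⊕ u ⊛ comp (tail K))) j + (const (H 0) ⊛ comp (tail K)) j ∎

    comp-^ : ∀ H k → comp (H ^ˢ k) ≋ comp H ^ˢ k
    comp-^ H zero    = comp-𝟙
    comp-^ H (suc k) = FPS.trans (comp-⊛ H (H ^ˢ k)) (FPS.*-congˡ {comp H} (comp-^ H k))

    comp-⊝ : ∀ H → comp (⊝ H) ≋ ⊝ comp H
    comp-⊝ H = FPS.inverseʳ-unique (comp H) (comp (⊝ H)) (FPS.trans (FPS.sym (comp-⊕ H (⊝ H)))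
                 (FPS.trans (comp-cong (FPS.trans (FPS.-‿inverseʳ H) (FPS.sym const-0))) (FPS.trans (comp-const 0#) const-0)))

    comp-quadratic : ∀ a b V → comp (quadratic a b V) ≋ quadratic a b (comp V)
    comp-quadratic a b V = begin⟨ FPS.setoid ⟩
      comp (𝟙 ⊕ const a ⊛ V ⊕ const b ⊛ (V ⊛ V))
        ≈⟨ comp-⊕ (𝟙 ⊕ const a ⊛ V) (const b ⊛ (V ⊛ V)) ⟩
      comp (𝟙 ⊕ const a ⊛ V) ⊕ comp (const b ⊛ (V ⊛ V))
        ≈⟨ FPS.+-cong (comp-⊕ 𝟙 (const a ⊛ V)) (comp-⊛ (const b) (V ⊛ V)) ⟩
      (comp 𝟙 ⊕ comp (const a ⊛ V)) ⊕ comp (const b) ⊛ comp (V ⊛ V)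
        ≈⟨ FPS.+-cong (FPS.+-cong comp-𝟙 (FPS.trans (comp-⊛ (const a) V) (FPS.*-congʳ {comp V} (comp-const a))))
                      (FPS.*-cong (comp-const b) (comp-⊛ V V)) ⟩
      𝟙 ⊕ const a ⊛ comp V ⊕ const b ⊛ (comp V ⊛ comp V) ∎

    comp-inverse : ∀ H K → H ⊛ K ≋ 𝟙 → comp H ⊛ comp K ≋ 𝟙
    comp-inverse H K HK≋1 = FPS.trans (FPS.sym (comp-⊛ H K)) (FPS.trans (comp-cong HK≋1) comp-𝟙)

    horner-coeff : ∀ N H m → horner N H m ≈ Σ N (λ j → H j * (u ^ˢ j) m)
    horner-coeff zero    H zero    = sym (*-identityʳ _)
    horner-coeff zero    H (suc m) = sym (zeroʳ _)
    horner-coeff (suc N) H m = begin⟨ setoid ⟩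
      const (H 0) m + (u ⊛ horner N (tail H)) m
        ≈⟨ +-cong (const-coeff m) (Σ-cong m (λ k → *-congˡ (horner-coeff N (tail H) (m ∸ k)))) ⟩
      H 0 * 𝟙 m + Σ m (λ k → u k * Σ N (λ j → H (suc j) * (u ^ˢ j) (m ∸ k)))
        ≈⟨ +-congˡ (Σ-cong m (λ k → *-distribˡ-Σ N _ _)) ⟩
      H 0 * 𝟙 m + Σ m (λ k → Σ N (λ j → u k * (H (suc j) * (u ^ˢ j) (m ∸ k))))
        ≈⟨ +-congˡ (Σ-comm m N _) ⟩
      H 0 * 𝟙 m + Σ N (λ j → Σ m (λ k → u k * (H (suc j) * (u ^ˢ j) (m ∸ k))))
        ≈⟨ +-congˡ (Σ-cong N (λ j → trans (Σ-cong m (λ k → x∙yz≈y∙xz _ _ _)) (sym (*-distribˡ-Σ m _ _)))) ⟩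
      H 0 * 𝟙 m + Σ N (λ j → H (suc j) * (u ^ˢ suc j) m)
        ≈⟨ Σ-unfoldˡ N _ ⟨
      Σ (suc N) (λ j → H j * (u ^ˢ j) m) ∎
      where
      const-coeff : ∀ m → const (H 0) m ≈ H 0 * 𝟙 m
      const-coeff zero    = sym (*-identityʳ _)
      const-coeff (suc m) = sym (zeroʳ _)

    comp-coeff : ∀ H n → comp H n ≈ Σ n (λ j → H j * (u ^ˢ j) n)
    comp-coeff H n = horner-coeff n H n

module Lagrange {c ℓ} (R : CommutativeRing c ℓ) (s α : CommutativeRing.Carrier R) where

  open CommutativeRing R
  open FiniteSums R
  open PowerSeries R
  open import Relation.Binary.Reasoning.MultiSetoid
  open import Algebra.Properties.Ring ring using (-0#≈0#)
  open import Algebra.Properties.CommutativeSemigroup *-commutativeSemigroup using (x∙yz≈y∙xz)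

  Φ : FPS → FPS
  Φ = quadratic s α

  φ : FPS
  φ = Φ X

  Φ⊛-coeff : ∀ V W n → (Φ V ⊛ W) n ≈ W n + s * (V ⊛ W) n + α * (V ⊛ (V ⊛ W)) n
  Φ⊛-coeff V W n = begin⟨ setoid ⟩
    ((𝟙 ⊕ const s ⊛ V ⊕ const α ⊛ (V ⊛ V)) ⊛ W) n
      ≈⟨ FPS.distribʳ W (𝟙 ⊕ const s ⊛ V) (const α ⊛ (V ⊛ V)) n ⟩
    ((𝟙 ⊕ const s ⊛ V) ⊛ W) n + ((const α ⊛ (V ⊛ V)) ⊛ W) n
      ≈⟨ +-cong (FPS.distribʳ W 𝟙 (const s ⊛ V) n) (FPS.trans (FPS.*-assoc (const α) (V ⊛ V) W) (FPS.*-congˡ {const α} (FPS.*-assoc V V W)) n) ⟩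
    ((𝟙 ⊛ W) n + ((const s ⊛ V) ⊛ W) n) + (const α ⊛ (V ⊛ (V ⊛ W))) n
      ≈⟨ +-cong (+-cong (FPS.*-identityˡ W n) (trans (FPS.*-assoc (const s) V W n) (const-⊛ s (V ⊛ W) n))) (const-⊛ α (V ⊛ (V ⊛ W)) n) ⟩
    W n + s * (V ⊛ W) n + α * (V ⊛ (V ⊛ W)) n ∎

  X^⊛φ⊛-coeff : ∀ b P a → (X ^ˢ b ⊛ (φ ⊛ P)) a ≈ (X ^ˢ b ⊛ P) a + s * (X ^ˢ suc b ⊛ P) a + α * (X ^ˢ suc (suc b) ⊛ P) a
  X^⊛φ⊛-coeff b P a = begin⟨ setoid ⟩
    (X ^ˢ b ⊛ (φ ⊛ P)) a  ≈⟨ FPS.x∙yz≈y∙xz (X ^ˢ b) φ P a ⟩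
    (φ ⊛ (X ^ˢ b ⊛ P)) a  ≈⟨ Φ⊛-coeff X (X ^ˢ b ⊛ P) a ⟩
    (X ^ˢ b ⊛ P) a + s * (X ⊛ (X ^ˢ b ⊛ P)) a + α * (X ⊛ (X ⊛ (X ^ˢ b ⊛ P))) a
      ≈⟨ +-cong (+-congˡ (*-congˡ (FPS.*-assoc X (X ^ˢ b) P a)))
                (*-congˡ (trans (FPS.*-assoc X (X ^ˢ suc b) P a) (⊛-cong {X} FPS.refl (FPS.*-assoc X (X ^ˢ b) P) a))) ⟨
    (X ^ˢ b ⊛ P) a + s * (X ^ˢ suc b ⊛ P) a + α * (X ^ˢ suc (suc b) ⊛ P) a ∎

  module _ (m : ℕ) (IH : ∀ d → (φ ^ˢ m) (m ℕ.+ d) ≈ α ^ d * (X ^ˢ d ⊛ φ ^ˢ m) m) where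

    private
      P : FPS
      P = φ ^ˢ m

    palindromic-shift : ∀ d → α * (X ^ˢ 1 ⊛ P) (m ℕ.+ d) ≈ α ^ d * (X ^ˢ d ⊛ P) (suc m)
    palindromic-shift zero = begin⟨ setoid ⟩
      α * (X ^ˢ 1 ⊛ P) (m ℕ.+ 0)  ≈⟨ *-congˡ (reflexive (≡.cong (X ^ˢ 1 ⊛ P) (ℕ.+-identityʳ m))) ⟩
      α * (X ^ˢ 1 ⊛ P) m          ≈⟨ trans (IH 1) (*-congʳ (*-identityʳ α)) ⟨
      P (m ℕ.+ 1)                 ≈⟨ reflexive (≡.cong P (ℕ.+-comm m 1)) ⟩
      P (suc m)                   ≈⟨ trans (*-identityˡ _) (⊛-identityˡ P (suc m)) ⟨
      1# * (X ^ˢ 0 ⊛ P) (suc m)   ∎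
    palindromic-shift (suc d) = begin⟨ setoid ⟩
      α * (X ^ˢ 1 ⊛ P) (m ℕ.+ suc d)       ≈⟨ *-congˡ (reflexive (≡.cong (X ^ˢ 1 ⊛ P) (ℕ.+-suc m d))) ⟩
      α * (X ^ˢ 1 ⊛ P) (suc (m ℕ.+ d))     ≈⟨ *-congˡ (trans (X^⊛-suc 0 P (m ℕ.+ d)) (⊛-identityˡ P _)) ⟩
      α * P (m ℕ.+ d)                      ≈⟨ *-congˡ (IH d) ⟩
      α * (α ^ d * (X ^ˢ d ⊛ P) m)         ≈⟨ *-assoc _ _ _ ⟨
      α ^ suc d * (X ^ˢ d ⊛ P) m           ≈⟨ *-congˡ (X^⊛-suc d P m) ⟨
      α ^ suc d * (X ^ˢ suc d ⊛ P) (suc m) ∎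

    palindromic-step : ∀ d → (φ ⊛ P) (suc m ℕ.+ d) ≈ α ^ d * (X ^ˢ d ⊛ (φ ⊛ P)) (suc m)
    palindromic-step d = begin⟨ setoid ⟩
      (φ ⊛ P) (suc m ℕ.+ d)                     ≈⟨ ⊛-identityˡ (φ ⊛ P) (suc m ℕ.+ d) ⟨
      (X ^ˢ 0 ⊛ (φ ⊛ P)) (suc (m ℕ.+ d))        ≈⟨ X^⊛φ⊛-coeff 0 P (suc (m ℕ.+ d)) ⟩
      (X ^ˢ 0 ⊛ P) (suc (m ℕ.+ d)) + s * (X ^ˢ 1 ⊛ P) (suc (m ℕ.+ d)) + α * (X ^ˢ 2 ⊛ P) (suc (m ℕ.+ d))
        ≈⟨ +-cong (+-cong (⊛-identityˡ P _) (*-congˡ (trans (X^⊛-suc 0 P (m ℕ.+ d)) (⊛-identityˡ P _))))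
                  (*-congˡ (X^⊛-suc 1 P (m ℕ.+ d))) ⟩
      P (suc (m ℕ.+ d)) + s * P (m ℕ.+ d) + α * (X ^ˢ 1 ⊛ P) (m ℕ.+ d)
        ≈⟨ +-cong (+-cong top middle) (palindromic-shift d) ⟩
      α ^ d * (α * C) + α ^ d * (s * B) + α ^ d * A
        ≈⟨ trans (+-comm _ _) (trans (+-congˡ (+-comm _ _)) (sym (+-assoc _ _ _))) ⟩
      α ^ d * A + α ^ d * (s * B) + α ^ d * (α * C)
        ≈⟨ trans (distribˡ _ _ _) (+-congʳ (distribˡ _ _ _)) ⟨
      α ^ d * (A + s * B + α * C)
        ≈⟨ *-congˡ (+-cong (+-congˡ (*-congˡ (X^⊛-suc d P m))) (*-congˡ (X^⊛-suc (suc d) P m))) ⟨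
      α ^ d * ((X ^ˢ d ⊛ P) (suc m) + s * (X ^ˢ suc d ⊛ P) (suc m) + α * (X ^ˢ suc (suc d) ⊛ P) (suc m))
        ≈⟨ *-congˡ (X^⊛φ⊛-coeff d P (suc m)) ⟨
      α ^ d * (X ^ˢ d ⊛ (φ ⊛ P)) (suc m) ∎
      where
      A B C : Carrier
      A = (X ^ˢ d ⊛ P) (suc m)
      B = (X ^ˢ d ⊛ P) m
      C = (X ^ˢ suc d ⊛ P) m
      top : P (suc (m ℕ.+ d)) ≈ α ^ d * (α * C)
      top = trans (reflexive (≡.cong P (≡.sym (ℕ.+-suc m d)))) (trans (IH (suc d)) (trans (*-congʳ (*-comm _ _)) (*-assoc _ _ _)))
      middle : s * P (m ℕ.+ d) ≈ α ^ d * (s * B)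
      middle = trans (*-congˡ (IH d)) (x∙yz≈y∙xz _ _ _)

  -- φ(z) = z² α φ(1/(α z)), so the coefficients of φ^m are symmetric about z^m up to powers of α.
  φ^-palindromic : ∀ m d → (φ ^ˢ m) (m ℕ.+ d) ≈ α ^ d * (X ^ˢ d ⊛ φ ^ˢ m) m
  φ^-palindromic zero    zero    = sym (trans (*-identityˡ _) (*-identityˡ _))
  φ^-palindromic zero    (suc d) = sym (trans (*-congˡ (X^⊛-< (suc d) 𝟙 0 (s≤s z≤n))) (zeroʳ _))
  φ^-palindromic (suc m) d       = palindromic-step m (φ^-palindromic m) d

  αz² 1-αz² : FPS
  αz²   = const α ⊛ X ^ˢ 2
  1-αz² = 𝟙 ⊕ ⊝ αz²

  -- φ - z φ′ = 1 - α z², so this is the kernel φ^(n+1) (1 - z φ′/φ) of Lagrange inversion.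
  kernel : ℕ → FPS
  kernel n = φ ^ˢ n ⊛ 1-αz²

  kernel-suc : ∀ m → kernel m (suc m) ≈ 0#
  kernel-suc m = begin⟨ setoid ⟩
    (P ⊛ 1-αz²) (suc m)
      ≈⟨ FPS.distribˡ P 𝟙 (⊝ (const α ⊛ X ^ˢ 2)) (suc m) ⟩
    (P ⊛ 𝟙) (suc m) + (P ⊛ ⊝ (const α ⊛ X ^ˢ 2)) (suc m)
      ≈⟨ +-cong (FPS.*-identityʳ P (suc m)) (trans (FPS.sym (⊝-distribʳ-⊛ P (const α ⊛ X ^ˢ 2)) (suc m))
                  (-‿cong (FPS.x∙yz≈y∙xz P (const α) (X ^ˢ 2) (suc m)))) ⟩
    P (suc m) + - (const α ⊛ (P ⊛ X ^ˢ 2)) (suc m)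
      ≈⟨ +-congˡ (-‿cong (trans (const-⊛ α (P ⊛ X ^ˢ 2) (suc m)) (*-congˡ (trans (FPS.*-comm P (X ^ˢ 2) (suc m)) (X^⊛-suc 1 P m))))) ⟩
    P (suc m) + - (α * (X ^ˢ 1 ⊛ P) m)
      ≈⟨ +-congʳ (trans (reflexive (≡.cong P (ℕ.+-comm 1 m))) (trans (φ^-palindromic m 1) (*-congʳ (*-identityʳ α)))) ⟩
    α * (X ^ˢ 1 ⊛ P) m + - (α * (X ^ˢ 1 ⊛ P) m)
      ≈⟨ -‿inverseʳ _ ⟩
    0# ∎
    where
    P = φ ^ˢ m

  module Inversion (u : FPS) (u≋XΦu : u ≋ X ⊛ Φ u) where

    u0 : u 0 ≈ 0#
    u0 = trans (u≋XΦu 0) (X⊛-zero (Φ u))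

    open Composition u u0

    u^-suc-coeff : ∀ j n → (u ^ˢ suc j) (suc n) ≈ (u ^ˢ j) n + s * (u ^ˢ suc j) n + α * (u ^ˢ suc (suc j)) n
    u^-suc-coeff j n = begin⟨ setoid ⟩
      (u ⊛ u ^ˢ j) (suc n)               ≈⟨ ⊛-cong {g = u ^ˢ j} u≋XΦu FPS.refl (suc n) ⟩
      ((X ⊛ Φ u) ⊛ u ^ˢ j) (suc n)       ≈⟨ FPS.*-assoc X (Φ u) (u ^ˢ j) (suc n) ⟩
      (X ⊛ (Φ u ⊛ u ^ˢ j)) (suc n)       ≈⟨ X⊛-suc (Φ u ⊛ u ^ˢ j) n ⟩
      (Φ u ⊛ u ^ˢ j) n                   ≈⟨ Φ⊛-coeff u (u ^ˢ j) n ⟩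
      (u ^ˢ j) n + s * (u ^ˢ suc j) n + α * (u ^ˢ suc (suc j)) n ∎

    u^-suc-zero : ∀ j → (u ^ˢ suc j) 0 ≈ 0#
    u^-suc-zero j = trans (*-congʳ u0) (zeroˡ _)

    -- Both sides satisfy the recurrence u^-suc-coeff in (j, n), with the same initial values.
    u^-coeff : ∀ n j → (u ^ˢ j) (suc n) ≈ (X ^ˢ j ⊛ kernel n) (suc n)
    u^-coeff n zero = sym (trans (⊛-identityˡ (kernel n) (suc n)) (kernel-suc n))
    u^-coeff zero (suc j) = begin⟨ setoid ⟩
      (u ^ˢ suc j) 1                                           ≈⟨ u^-suc-coeff j 0 ⟩
      (u ^ˢ j) 0 + s * (u ^ˢ suc j) 0 + α * (u ^ˢ suc (suc j)) 0
        ≈⟨ trans (+-cong (+-congˡ (trans (*-congˡ (u^-suc-zero j)) (zeroʳ s))) (trans (*-congˡ (u^-suc-zero (suc j))) (zeroʳ α)))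
                 (trans (+-identityʳ _) (+-identityʳ _)) ⟩
      (u ^ˢ j) 0                                               ≈⟨ initial j ⟩
      (X ^ˢ j ⊛ kernel 0) 0                                    ≈⟨ X^⊛-suc j (kernel 0) 0 ⟨
      (X ^ˢ suc j ⊛ kernel 0) 1                                ∎
      where
      initial : ∀ j → (u ^ˢ j) 0 ≈ (X ^ˢ j ⊛ kernel 0) 0
      initial zero = sym (trans (*-identityˡ _) (trans (*-identityˡ _)
                       (trans (+-congˡ (trans (-‿cong (trans (const-⊛ α (X ^ˢ 2) 0) (trans (*-congˡ (X⊛-zero (X ^ˢ 1))) (zeroʳ α)))) -0#≈0#))
                              (+-identityʳ _))))
      initial (suc j) = trans (u^-suc-zero j) (sym (X^⊛-< (suc j) (kernel 0) 0 (s≤s z≤n)))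
    u^-coeff (suc n) (suc j) = begin⟨ setoid ⟩
      (u ^ˢ suc j) (suc (suc n))
        ≈⟨ u^-suc-coeff j (suc n) ⟩
      (u ^ˢ j) (suc n) + s * (u ^ˢ suc j) (suc n) + α * (u ^ˢ suc (suc j)) (suc n)
        ≈⟨ +-cong (+-cong (u^-coeff n j) (*-congˡ (u^-coeff n (suc j)))) (*-congˡ (u^-coeff n (suc (suc j)))) ⟩
      (X ^ˢ j ⊛ kernel n) (suc n) + s * (X ^ˢ suc j ⊛ kernel n) (suc n) + α * (X ^ˢ suc (suc j) ⊛ kernel n) (suc n)
        ≈⟨ X^⊛φ⊛-coeff j (kernel n) (suc n) ⟨
      (X ^ˢ j ⊛ (φ ⊛ kernel n)) (suc n)              ≈⟨ X^⊛-suc j (φ ⊛ kernel n) (suc n) ⟨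
      (X ^ˢ suc j ⊛ (φ ⊛ kernel n)) (suc (suc n))    ≈⟨ ⊛-cong {X ^ˢ suc j} FPS.refl (FPS.*-assoc φ (φ ^ˢ n) 1-αz²) (suc (suc n)) ⟨
      (X ^ˢ suc j ⊛ kernel (suc n)) (suc (suc n))    ∎

    lagrange-inversion : ∀ H n → comp H (suc n) ≈ (H ⊛ kernel n) (suc n)
    lagrange-inversion H n = trans (comp-coeff H (suc n)) (Σ-cong≤ (suc n) (λ j j≤ →
      *-congˡ (trans (u^-coeff n j) (X^⊛-≥ j (kernel n) (suc n) j≤))))

module Motzkin {c ℓ} (R : CommutativeRing c ℓ) (x y α : CommutativeRing.Carrier R) where

  open CommutativeRing R
  open FiniteSums R
  open PowerSeries R
  open Lagrange R (x + y) α
  open import Relation.Binary.Reasoning.MultiSetoid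
  open import Algebra.Properties.CommutativeSemiring.Exp commutativeSemiring using (^-homo-*)
  module *-Solver = Algebra.Solver.CommutativeMonoid *-commutativeMonoid
  open ⊛-Solver using (_⊜_) renaming (solve to ⊛-solve; _⊕_ to _·_)
  open *-Solver using () renaming (solve to *-solve; _⊕_ to _∙_; _⊜_ to _⊜′_)
  open ⊕-Solver using () renaming (solve to ⊕-solve; _⊕_ to _+ₑ_; _⊜_ to _⊜″_)

  ψ 1+xz : FPS
  ψ    = quadratic x α X
  1+xz = 𝟙 ⊕ const x ⊛ X

  X⊛X≋X^2 : X ⊛ X ≋ X ^ˢ 2
  X⊛X≋X^2 = FPS.*-congˡ {X} (FPS.sym (FPS.*-identityʳ X))

  ψ≋αz²⊕1+xz : ψ ≋ αz² ⊕ 1+xz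
  ψ≋αz²⊕1+xz = FPS.trans (FPS.+-comm 1+xz (const α ⊛ (X ⊛ X))) (FPS.+-congʳ (FPS.*-congˡ {const α} X⊛X≋X^2))

  Φ≋quadratic⊕yV : ∀ V → Φ V ≋ quadratic x α V ⊕ const y ⊛ V
  Φ≋quadratic⊕yV V =
    FPS.trans (FPS.+-congʳ (FPS.+-congˡ {𝟙} (FPS.trans (FPS.*-congʳ {V} (const-+ x y)) (FPS.distribʳ V (const x) (const y)))))
    (⊕-solve 4 (λ o a b z → (o +ₑ (a +ₑ b)) +ₑ z ⊜″ ((o +ₑ a) +ₑ z) +ₑ b) FPS.refl 𝟙 (const x ⊛ V) (const y ⊛ V) (const α ⊛ (V ⊛ V)))

  φ≋yz⊕ψ : φ ≋ const y ⊛ X ⊕ ψ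
  φ≋yz⊕ψ = FPS.trans (Φ≋quadratic⊕yV X) (FPS.+-comm ψ (const y ⊛ X))

  const⊛X^-^ : ∀ a j e → (const a ⊛ X ^ˢ j) ^ˢ e ≋ const (a ^ e) ⊛ X ^ˢ (j ℕ.* e)
  const⊛X^-^ a j e = FPS.trans (^ˢ-distrib-* (const a) (X ^ˢ j) e) (FPS.*-cong (const-^ a e) (^ˢ-assocʳ X j e))

  1+xz^-coeff : ∀ r j → (1+xz ^ˢ r) j ≈ (r C j) × x ^ j
  1+xz^-coeff zero    zero    = sym (+-identityʳ 1#)
  1+xz^-coeff zero    (suc j) = refl
  1+xz^-coeff (suc r) j = trans (FPS.distribʳ (1+xz ^ˢ r) 𝟙 (const x ⊛ X) j)
    (trans (+-cong (FPS.*-identityˡ (1+xz ^ˢ r) j) (trans (FPS.*-assoc (const x) X (1+xz ^ˢ r) j) (const-⊛ x (X ⊛ 1+xz ^ˢ r) j))) (pascal j))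
    where
    pascal : ∀ j → (1+xz ^ˢ r) j + x * (X ⊛ 1+xz ^ˢ r) j ≈ (suc r C j) × x ^ j
    pascal zero    = trans (+-cong (1+xz^-coeff r 0) (trans (*-congˡ (X⊛-zero (1+xz ^ˢ r))) (zeroʳ x))) (+-identityʳ _)
    pascal (suc j) = begin⟨ setoid ⟩
      (1+xz ^ˢ r) (suc j) + x * (X ⊛ 1+xz ^ˢ r) (suc j)
        ≈⟨ +-cong (1+xz^-coeff r (suc j)) (*-congˡ (trans (X⊛-suc (1+xz ^ˢ r) j) (1+xz^-coeff r j))) ⟩
      (r C suc j) × x ^ suc j + x * ((r C j) × x ^ j)   ≈⟨ +-congˡ (×-comm-* (r C j) x (x ^ j)) ⟩
      (r C suc j) × x ^ suc j + (r C j) × x ^ suc j     ≈⟨ trans (+-comm _ _) (sym (×-homo-+ (x ^ suc j) (r C j) (r C suc j))) ⟩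
      (r C j ℕ.+ r C suc j) × x ^ suc j                 ≈⟨ reflexive (≡.cong (_× x ^ suc j) (nCk+nC[k+1]≡[n+1]C[k+1] r j)) ⟩
      (suc r C suc j) × x ^ suc j                       ∎

  monomial : ℕ → ℕ → ℕ → ℕ → Carrier
  monomial q a b e = q × (x ^ a * (y ^ b * α ^ e))

  -- coefficient K T (K + T + 1 + N) is made of the monomials x^(N-d-2e) y^d α^(e+K+1).
  binomials : ℕ → ℕ → ℕ → ℕ → ℕ → ℕ
  binomials n T N d e = (n C d) ℕ.* ((m C e) ℕ.* ((m ∸ e ∸ 1) C (N ∸ d ∸ (e ℕ.+ e))))
    where m = suc (T ℕ.+ (N ∸ d))

  summand : ℕ → ℕ → ℕ → ℕ → ℕ → ℕ → Carrier
  summand n T N K d e = when (e ℕ.+ e ℕ.≤? N ∸ d) (monomial (binomials n T N d e) (N ∸ d ∸ (e ℕ.+ e)) d (e ℕ.+ suc K))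

  expanded-term : ℕ → ℕ → ℕ → ℕ → ℕ → Carrier
  expanded-term n T N K d = when (d ℕ.≤? N) (Σ (suc (T ℕ.+ (N ∸ d))) (summand n T N K d))

  module Coefficients (1/ψ : FPS) (ψ⊛1/ψ : ψ ⊛ 1/ψ ≋ 𝟙)
                      (1/[1+xz] : FPS) (1+xz⊛1/[1+xz] : 1+xz ⊛ 1/[1+xz] ≋ 𝟙)
                      (1/[1-αz²] : FPS) (1-αz²⊛1/[1-αz²] : 1-αz² ⊛ 1/[1-αz²] ≋ 𝟙) where

    1+xz^⊛1/[1+xz] : ∀ r → 1+xz ^ˢ suc r ⊛ 1/[1+xz] ≋ 1+xz ^ˢ r
    1+xz^⊛1/[1+xz] r = FPS.trans (FPS.*-congʳ {1/[1+xz]} (FPS.*-comm 1+xz (1+xz ^ˢ r)))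
                                 (cancel-inverseʳ 1+xz 1/[1+xz] (1+xz ^ˢ r) 1+xz⊛1/[1+xz])

    ψ^⊛1/ψ^ : ∀ m K → ψ ^ˢ (m ℕ.+ K) ⊛ (1/ψ ^ˢ K ⊛ 1/[1+xz]) ≋ ψ ^ˢ m ⊛ 1/[1+xz]
    ψ^⊛1/ψ^ m K = begin⟨ FPS.setoid ⟩
      ψ ^ˢ (m ℕ.+ K) ⊛ (1/ψ ^ˢ K ⊛ 1/[1+xz])           ≈⟨ FPS.*-congʳ {1/ψ ^ˢ K ⊛ 1/[1+xz]} (^ˢ-homo-* ψ m K) ⟩
      (ψ ^ˢ m ⊛ ψ ^ˢ K) ⊛ (1/ψ ^ˢ K ⊛ 1/[1+xz])
        ≈⟨ ⊛-solve 4 (λ a b c d → (a · b) · (c · d) ⊜ (a · d) · (b · c)) FPS.refl (ψ ^ˢ m) (ψ ^ˢ K) (1/ψ ^ˢ K) 1/[1+xz] ⟩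
      (ψ ^ˢ m ⊛ 1/[1+xz]) ⊛ (ψ ^ˢ K ⊛ 1/ψ ^ˢ K)
        ≈⟨ FPS.*-congˡ {ψ ^ˢ m ⊛ 1/[1+xz]} (FPS.trans (FPS.sym (^ˢ-distrib-* ψ 1/ψ K)) ([ψ⊛1/ψ]^≋𝟙 K)) ⟩
      (ψ ^ˢ m ⊛ 1/[1+xz]) ⊛ 𝟙                           ≈⟨ FPS.*-identityʳ _ ⟩
      ψ ^ˢ m ⊛ 1/[1+xz]                                  ∎
      where
      [ψ⊛1/ψ]^≋𝟙 : ∀ K → (ψ ⊛ 1/ψ) ^ˢ K ≋ 𝟙
      [ψ⊛1/ψ]^≋𝟙 zero    = FPS.refl
      [ψ⊛1/ψ]^≋𝟙 (suc K) = FPS.trans (FPS.*-cong ψ⊛1/ψ ([ψ⊛1/ψ]^≋𝟙 K)) (FPS.*-identityˡ 𝟙)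

    -- [z^I] ψ^m / (1 + xz), expanded by the binomial theorem in ψ = αz² + (1 + xz)
    inner-term : ℕ → ℕ → ℕ → Carrier
    inner-term m I e = when (e ℕ.+ e ℕ.≤? I) ((m C e) × (α ^ e * ((m ∸ e ∸ 1) C j) × x ^ j))
      where j = I ∸ (e ℕ.+ e)

    ψ^⊛1/[1+xz]-coeff : ∀ m I → I < m → (ψ ^ˢ m ⊛ 1/[1+xz]) I ≈ Σ m (inner-term m I)
    ψ^⊛1/[1+xz]-coeff m I I<m = begin⟨ setoid ⟩
      (ψ ^ˢ m ⊛ 1/[1+xz]) I
        ≈⟨ FPS.*-congʳ {1/[1+xz]} (FPS.trans (^ˢ-congˡ m ψ≋αz²⊕1+xz) (binomial-theoremˢ m αz² 1+xz)) I ⟩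
      (Σˢ m F ⊛ 1/[1+xz]) I                         ≈⟨ ⊛-distribʳ-Σˢ m 1/[1+xz] F I ⟩
      Σˢ m (λ e → F e ⊛ 1/[1+xz]) I                 ≈⟨ Σˢ-coeff m _ I ⟩
      Σ m (λ e → (F e ⊛ 1/[1+xz]) I)                ≈⟨ Σ-cong m term ⟩
      Σ m (inner-term m I)                          ∎
      where
      F : ℕ → FPS
      F e = (m C e) ×ˢ (αz² ^ˢ e ⊛ 1+xz ^ˢ (m ∸ e))
      term : ∀ e → (F e ⊛ 1/[1+xz]) I ≈ inner-term m I e
      term e = begin⟨ setoid ⟩
        (F e ⊛ 1/[1+xz]) I
          ≈⟨ FPS.trans (×ˢ-assoc-⊛ (m C e) (αz² ^ˢ e ⊛ 1+xz ^ˢ (m ∸ e)) 1/[1+xz]) (×ˢ-congʳ (m C e) regroup) I ⟩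
        ((m C e) ×ˢ (const (α ^ e) ⊛ (X ^ˢ (2 ℕ.* e) ⊛ (1+xz ^ˢ (m ∸ e) ⊛ 1/[1+xz])))) I
          ≈⟨ ×ˢ-const-X^-coeff (m C e) (α ^ e) (2 ℕ.* e) (1+xz ^ˢ (m ∸ e) ⊛ 1/[1+xz]) I ⟩
        when (2 ℕ.* e ℕ.≤? I) ((m C e) × (α ^ e * (1+xz ^ˢ (m ∸ e) ⊛ 1/[1+xz]) (I ∸ 2 ℕ.* e)))
          ≈⟨ reflexive (≡.cong (λ k → when (k ℕ.≤? I) ((m C e) × (α ^ e * (1+xz ^ˢ (m ∸ e) ⊛ 1/[1+xz]) (I ∸ k)))) 2e≡e+e) ⟩
        when (e ℕ.+ e ℕ.≤? I) ((m C e) × (α ^ e * (1+xz ^ˢ (m ∸ e) ⊛ 1/[1+xz]) (I ∸ (e ℕ.+ e))))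
          ≈⟨ when-cong (e ℕ.+ e ℕ.≤? I) (λ 2e≤I → ×-congʳ (m C e) (*-congˡ (cancel 2e≤I))) ⟩
        inner-term m I e ∎
        where
        2e≡e+e : 2 ℕ.* e ≡ e ℕ.+ e
        2e≡e+e = ≡.cong (e ℕ.+_) (ℕ.+-identityʳ e)
        regroup : (αz² ^ˢ e ⊛ 1+xz ^ˢ (m ∸ e)) ⊛ 1/[1+xz] ≋ const (α ^ e) ⊛ (X ^ˢ (2 ℕ.* e) ⊛ (1+xz ^ˢ (m ∸ e) ⊛ 1/[1+xz]))
        regroup = FPS.trans (FPS.*-assoc (αz² ^ˢ e) (1+xz ^ˢ (m ∸ e)) 1/[1+xz])
                    (FPS.trans (FPS.*-congʳ {1+xz ^ˢ (m ∸ e) ⊛ 1/[1+xz]} (const⊛X^-^ α 2 e))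
                               (FPS.*-assoc (const (α ^ e)) (X ^ˢ (2 ℕ.* e)) (1+xz ^ˢ (m ∸ e) ⊛ 1/[1+xz])))
        cancel : e ℕ.+ e ≤ I → (1+xz ^ˢ (m ∸ e) ⊛ 1/[1+xz]) (I ∸ (e ℕ.+ e)) ≈ ((m ∸ e ∸ 1) C (I ∸ (e ℕ.+ e))) × x ^ (I ∸ (e ℕ.+ e))
        cancel 2e≤I with m ∸ e | ℕ.m<n⇒0<n∸m (ℕ.≤-<-trans (ℕ.≤-trans (ℕ.m≤m+n e e) 2e≤I) I<m)
        ... | suc r | _ = trans (1+xz^⊛1/[1+xz] r (I ∸ (e ℕ.+ e))) (1+xz^-coeff r (I ∸ (e ℕ.+ e)))

    W : ℕ → ℕ → FPS
    W K n = (1/ψ ^ˢ K ⊛ 1/[1+xz]) ⊛ φ ^ˢ n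

    -- [z^N] W K n, expanded by the binomial theorem in φ = yz + ψ
    outer-term : ℕ → ℕ → ℕ → ℕ → Carrier
    outer-term n T N d = when (d ℕ.≤? N) ((n C d) × (y ^ d * Σ m (inner-term m (N ∸ d))))
      where m = suc (T ℕ.+ (N ∸ d))

    W-coeff : ∀ K T N → W K (suc (K ℕ.+ T) ℕ.+ N) N ≈ Σ (suc (K ℕ.+ T) ℕ.+ N) (outer-term (suc (K ℕ.+ T) ℕ.+ N) T N)
    W-coeff K T N = begin⟨ setoid ⟩
      (I ⊛ φ ^ˢ n) N
        ≈⟨ FPS.*-congˡ {I} (FPS.trans (^ˢ-congˡ n φ≋yz⊕ψ) (binomial-theoremˢ n (const y ⊛ X) ψ)) N ⟩
      (I ⊛ Σˢ n G) N                 ≈⟨ ⊛-distribˡ-Σˢ n I G N ⟩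
      Σˢ n (λ d → I ⊛ G d) N         ≈⟨ Σˢ-coeff n _ N ⟩
      Σ n (λ d → (I ⊛ G d) N)        ≈⟨ Σ-cong n term ⟩
      Σ n (outer-term n T N)         ∎
      where
      n = suc (K ℕ.+ T) ℕ.+ N
      I = 1/ψ ^ˢ K ⊛ 1/[1+xz]
      G : ℕ → FPS
      G d = (n C d) ×ˢ ((const y ⊛ X) ^ˢ d ⊛ ψ ^ˢ (n ∸ d))
      regroup : ∀ d → I ⊛ ((const y ⊛ X) ^ˢ d ⊛ ψ ^ˢ (n ∸ d)) ≋ const (y ^ d) ⊛ (X ^ˢ d ⊛ (ψ ^ˢ (n ∸ d) ⊛ I))
      regroup d = FPS.trans (FPS.*-congˡ {I} (FPS.*-congʳ {ψ ^ˢ (n ∸ d)}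
                    (FPS.trans (^ˢ-distrib-* (const y) X d) (FPS.*-congʳ {X ^ˢ d} (const-^ y d)))))
                    (⊛-solve 4 (λ i c z p → i · ((c · z) · p) ⊜ c · (z · (p · i))) FPS.refl I (const (y ^ d)) (X ^ˢ d) (ψ ^ˢ (n ∸ d)))
      n∸d≡m+K : ∀ d → d ≤ N → n ∸ d ≡ suc (T ℕ.+ (N ∸ d)) ℕ.+ K
      n∸d≡m+K d d≤N = begin-≡
        suc (K ℕ.+ T) ℕ.+ N ∸ d      ≡⟨ ℕ.+-∸-assoc (suc (K ℕ.+ T)) d≤N ⟩
        suc (K ℕ.+ T) ℕ.+ (N ∸ d)    ≡⟨ ≡.cong suc (ℕ.+-assoc K T (N ∸ d)) ⟩
        suc (K ℕ.+ (T ℕ.+ (N ∸ d)))  ≡⟨ ≡.cong suc (ℕ.+-comm K (T ℕ.+ (N ∸ d))) ⟩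
        suc (T ℕ.+ (N ∸ d)) ℕ.+ K    ∎-≡
        where open ≡.≡-Reasoning renaming (begin_ to begin-≡_; _∎ to _∎-≡)
      inner : ∀ d → d ≤ N → (ψ ^ˢ (n ∸ d) ⊛ I) (N ∸ d) ≈ Σ (suc (T ℕ.+ (N ∸ d))) (inner-term (suc (T ℕ.+ (N ∸ d))) (N ∸ d))
      inner d d≤N = trans (reflexive (≡.cong (λ k → (ψ ^ˢ k ⊛ I) (N ∸ d)) (n∸d≡m+K d d≤N)))
        (trans (ψ^⊛1/ψ^ (suc (T ℕ.+ (N ∸ d))) K (N ∸ d)) (ψ^⊛1/[1+xz]-coeff _ (N ∸ d) (s≤s (ℕ.m≤n+m (N ∸ d) T))))
      term : ∀ d → (I ⊛ G d) N ≈ outer-term n T N d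
      term d = begin⟨ setoid ⟩
        (I ⊛ G d) N
          ≈⟨ FPS.trans (×ˢ-comm-⊛ (n C d) I _) (×ˢ-congʳ (n C d) (regroup d)) N ⟩
        ((n C d) ×ˢ (const (y ^ d) ⊛ (X ^ˢ d ⊛ (ψ ^ˢ (n ∸ d) ⊛ I)))) N
          ≈⟨ ×ˢ-const-X^-coeff (n C d) (y ^ d) d (ψ ^ˢ (n ∸ d) ⊛ I) N ⟩
        when (d ℕ.≤? N) ((n C d) × (y ^ d * (ψ ^ˢ (n ∸ d) ⊛ I) (N ∸ d)))
          ≈⟨ when-cong (d ℕ.≤? N) (λ d≤N → ×-congʳ (n C d) (*-congˡ (inner d d≤N))) ⟩
        outer-term n T N d ∎

    coefficient : ℕ → ℕ → ℕ → Carrier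
    coefficient K T n = α ^ suc K * (X ^ˢ suc (suc (K ℕ.+ T)) ⊛ W K n) (suc n)

    coefficient-below : ∀ K T n → n < suc (K ℕ.+ T) → coefficient K T n ≈ 0#
    coefficient-below K T n n< = trans (*-congˡ (X^⊛-< (suc (suc (K ℕ.+ T))) (W K n) (suc n) (s≤s n<))) (zeroʳ _)

    ×-pull : ∀ a p b q c r z → a * (p × (b * (q × (c * (r × z))))) ≈ (p ℕ.* (q ℕ.* r)) × (a * (b * (c * z)))
    ×-pull a p b q c r z = begin⟨ setoid ⟩
      a * (p × (b * (q × (c * (r × z)))))   ≈⟨ *-congˡ (×-congʳ p (*-congˡ (×-congʳ q (×-comm-* r c z)))) ⟩
      a * (p × (b * (q × (r × (c * z)))))   ≈⟨ *-congˡ (×-congʳ p (*-congˡ (×-assocˡ (c * z) q r))) ⟩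
      a * (p × (b * ((q ℕ.* r) × (c * z)))) ≈⟨ *-congˡ (×-congʳ p (×-comm-* (q ℕ.* r) b (c * z))) ⟩
      a * (p × ((q ℕ.* r) × (b * (c * z)))) ≈⟨ *-congˡ (×-assocˡ (b * (c * z)) p (q ℕ.* r)) ⟩
      a * ((p ℕ.* (q ℕ.* r)) × (b * (c * z))) ≈⟨ ×-comm-* (p ℕ.* (q ℕ.* r)) a (b * (c * z)) ⟩
      (p ℕ.* (q ℕ.* r)) × (a * (b * (c * z))) ∎

    α^⊛inner-term : ∀ K n T N d e → let m = suc (T ℕ.+ (N ∸ d)) in
                    α ^ suc K * ((n C d) × (y ^ d * inner-term m (N ∸ d) e)) ≈ summand n T N K d e
    α^⊛inner-term K n T N d e with e ℕ.+ e ℕ.≤? N ∸ d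
    ... | no  _ = trans (*-congˡ (trans (×-congʳ (n C d) (zeroʳ _)) (×-zeroʳ (n C d)))) (zeroʳ _)
    ... | yes _ = trans (×-pull (α ^ suc K) (n C d) (y ^ d) (m C e) (α ^ e) ((m ∸ e ∸ 1) C j) (x ^ j))
                        (×-congʳ (binomials n T N d e) (begin⟨ setoid ⟩
      α ^ suc K * (y ^ d * (α ^ e * x ^ j))  ≈⟨ *-solve 4 (λ a b c z → a ∙ (b ∙ (c ∙ z)) ⊜′ z ∙ (b ∙ (c ∙ a)))
                                                          refl (α ^ suc K) (y ^ d) (α ^ e) (x ^ j) ⟩
      x ^ j * (y ^ d * (α ^ e * α ^ suc K))   ≈⟨ *-congˡ (*-congˡ (^-homo-* α e (suc K))) ⟨
      x ^ j * (y ^ d * α ^ (e ℕ.+ suc K))     ∎))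
      where
      m = suc (T ℕ.+ (N ∸ d))
      j = N ∸ d ∸ (e ℕ.+ e)

    α^⊛outer-term : ∀ K n T N d → α ^ suc K * outer-term n T N d ≈ expanded-term n T N K d
    α^⊛outer-term K n T N d = trans (*-distribˡ-when (d ℕ.≤? N) _ _) (when-cong (d ℕ.≤? N) (λ _ → begin⟨ setoid ⟩
      α ^ suc K * ((n C d) × (y ^ d * Σ m (inner-term m I)))     ≈⟨ *-congˡ (×-congʳ (n C d) (*-distribˡ-Σ m (y ^ d) _)) ⟩
      α ^ suc K * ((n C d) × Σ m (λ e → y ^ d * inner-term m I e)) ≈⟨ *-congˡ (×-distrib-Σ (n C d) m _) ⟩
      α ^ suc K * Σ m (λ e → (n C d) × (y ^ d * inner-term m I e)) ≈⟨ *-distribˡ-Σ m (α ^ suc K) _ ⟩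
      Σ m (λ e → α ^ suc K * ((n C d) × (y ^ d * inner-term m I e))) ≈⟨ Σ-cong m (α^⊛inner-term K n T N d) ⟩
      Σ m (summand n T N K d)                                     ∎))
      where
      I = N ∸ d
      m = suc (T ℕ.+ I)

    coefficient-expansion : ∀ K T N →
      coefficient K T (suc (K ℕ.+ T) ℕ.+ N) ≈ Σ (suc (K ℕ.+ T) ℕ.+ N) (expanded-term (suc (K ℕ.+ T) ℕ.+ N) T N K)
    coefficient-expansion K T N = begin⟨ setoid ⟩
      α ^ suc K * (X ^ˢ suc J ⊛ W K n) (suc n)
        ≈⟨ *-congˡ (trans (X^⊛-≥ (suc J) (W K n) (suc n) (s≤s (ℕ.m≤m+n J N))) (reflexive (≡.cong (W K n) (ℕ.m+n∸m≡n J N)))) ⟩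
      α ^ suc K * W K n N                         ≈⟨ *-congˡ (W-coeff K T N) ⟩
      α ^ suc K * Σ n (outer-term n T N)          ≈⟨ *-distribˡ-Σ n _ _ ⟩
      Σ n (λ d → α ^ suc K * outer-term n T N d)  ≈⟨ Σ-cong n (α^⊛outer-term K n T N) ⟩
      Σ n (expanded-term n T N K)                 ∎
      where
      J = suc (K ℕ.+ T)
      n = J ℕ.+ N

    αz/ψ αz²/ψ : FPS
    αz/ψ  = const α ⊛ (X ⊛ 1/ψ)
    αz²/ψ = const α ⊛ (X ⊛ (X ⊛ 1/ψ))

    H : ℕ → ℕ → FPS
    H k t = (αz/ψ ^ˢ k ⊛ ((𝟙 ⊕ ⊝ (αz²/ψ ^ˢ t)) ⊛ 1/[1+xz])) ⊛ (αz² ⊛ 1/[1-αz²])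

    αz/ψ^ : ∀ K → αz/ψ ^ˢ K ≋ const (α ^ K) ⊛ (X ^ˢ K ⊛ 1/ψ ^ˢ K)
    αz/ψ^ K = FPS.trans (^ˢ-distrib-* (const α) (X ⊛ 1/ψ) K) (FPS.*-cong (const-^ α K) (^ˢ-distrib-* X 1/ψ K))

    αz/ψ^⊛αz²/ψ^ : ∀ k t → αz/ψ ^ˢ k ⊛ αz²/ψ ^ˢ t ≋ const (α ^ (k ℕ.+ t)) ⊛ (X ^ˢ (k ℕ.+ (t ℕ.+ t)) ⊛ 1/ψ ^ˢ (k ℕ.+ t))
    αz/ψ^⊛αz²/ψ^ k t = begin⟨ FPS.setoid ⟩
      αz/ψ ^ˢ k ⊛ αz²/ψ ^ˢ t
        ≈⟨ FPS.*-cong (αz/ψ^ k) (FPS.trans (^ˢ-distrib-* (const α) (X ⊛ (X ⊛ 1/ψ)) t)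
             (FPS.*-cong (const-^ α t) (FPS.trans (^ˢ-distrib-* X (X ⊛ 1/ψ) t) (FPS.*-congˡ {X ^ˢ t} (^ˢ-distrib-* X 1/ψ t))))) ⟩
      (const (α ^ k) ⊛ (X ^ˢ k ⊛ 1/ψ ^ˢ k)) ⊛ (const (α ^ t) ⊛ (X ^ˢ t ⊛ (X ^ˢ t ⊛ 1/ψ ^ˢ t)))
        ≈⟨ ⊛-solve 6 (λ a z i b w j → (a · (z · i)) · (b · (w · (w · j))) ⊜ (a · b) · ((z · (w · w)) · (i · j)))
             FPS.refl (const (α ^ k)) (X ^ˢ k) (1/ψ ^ˢ k) (const (α ^ t)) (X ^ˢ t) (1/ψ ^ˢ t) ⟩
      (const (α ^ k) ⊛ const (α ^ t)) ⊛ ((X ^ˢ k ⊛ (X ^ˢ t ⊛ X ^ˢ t)) ⊛ (1/ψ ^ˢ k ⊛ 1/ψ ^ˢ t))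
        ≈⟨ FPS.*-cong (FPS.trans (const-* (α ^ k) (α ^ t)) (const-cong (sym (^-homo-* α k t))))
                      (FPS.*-cong (FPS.trans (FPS.*-congˡ {X ^ˢ k} (FPS.sym (^ˢ-homo-* X t t))) (FPS.sym (^ˢ-homo-* X k (t ℕ.+ t))))
                                  (FPS.sym (^ˢ-homo-* 1/ψ k t))) ⟩
      const (α ^ (k ℕ.+ t)) ⊛ (X ^ˢ (k ℕ.+ (t ℕ.+ t)) ⊛ 1/ψ ^ˢ (k ℕ.+ t)) ∎

    term : ℕ → ℕ → ℕ → FPS
    term K J n = const (α ^ suc K) ⊛ (X ^ˢ suc (suc J) ⊛ W K n)

    term≋ : ∀ K J n → (const (α ^ K) ⊛ (X ^ˢ J ⊛ 1/ψ ^ˢ K)) ⊛ (1/[1+xz] ⊛ (αz² ⊛ φ ^ˢ n)) ≋ term K J n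
    term≋ K J n = begin⟨ FPS.setoid ⟩
      (const (α ^ K) ⊛ (X ^ˢ J ⊛ 1/ψ ^ˢ K)) ⊛ (1/[1+xz] ⊛ ((const α ⊛ X ^ˢ 2) ⊛ φ ^ˢ n))
        ≈⟨ ⊛-solve 7 (λ a z i l b w p → (a · (z · i)) · (l · ((b · w) · p)) ⊜ (b · a) · ((w · z) · ((i · l) · p)))
             FPS.refl (const (α ^ K)) (X ^ˢ J) (1/ψ ^ˢ K) 1/[1+xz] (const α) (X ^ˢ 2) (φ ^ˢ n) ⟩
      (const α ⊛ const (α ^ K)) ⊛ ((X ^ˢ 2 ⊛ X ^ˢ J) ⊛ W K n)
        ≈⟨ FPS.*-cong (const-* α (α ^ K)) (FPS.*-congʳ {W K n} (FPS.sym (^ˢ-homo-* X 2 J))) ⟩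
      term K J n ∎

    H⊛kernel : ∀ k t n → H k t ⊛ kernel n ≋ term k (k ℕ.+ 0) n ⊕ ⊝ term (k ℕ.+ t) (k ℕ.+ t ℕ.+ t) n
    H⊛kernel k t n = begin⟨ FPS.setoid ⟩
      ((A ⊛ ((𝟙 ⊕ ⊝ B) ⊛ 1/[1+xz])) ⊛ (αz² ⊛ 1/[1-αz²])) ⊛ (φ ^ˢ n ⊛ 1-αz²)
        ≈⟨ ⊛-solve 7 (λ a b l d e p q → ((a · (b · l)) · (d · e)) · (p · q) ⊜ ((a · b) · (l · (d · p))) · (q · e))
             FPS.refl A (𝟙 ⊕ ⊝ B) 1/[1+xz] αz² 1/[1-αz²] (φ ^ˢ n) 1-αz² ⟩
      ((A ⊛ (𝟙 ⊕ ⊝ B)) ⊛ Rest) ⊛ (1-αz² ⊛ 1/[1-αz²])  ≈⟨ FPS.*-congˡ {(A ⊛ (𝟙 ⊕ ⊝ B)) ⊛ Rest} 1-αz²⊛1/[1-αz²] ⟩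
      ((A ⊛ (𝟙 ⊕ ⊝ B)) ⊛ Rest) ⊛ 𝟙                     ≈⟨ FPS.*-identityʳ _ ⟩
      (A ⊛ (𝟙 ⊕ ⊝ B)) ⊛ Rest                            ≈⟨ FPS.*-congʳ {Rest} (FPS.distribˡ A 𝟙 (⊝ B)) ⟩
      (A ⊛ 𝟙 ⊕ A ⊛ ⊝ B) ⊛ Rest                          ≈⟨ FPS.*-congʳ {Rest} (FPS.+-cong (FPS.*-identityʳ A) (FPS.sym (⊝-distribʳ-⊛ A B))) ⟩
      (A ⊕ ⊝ (A ⊛ B)) ⊛ Rest                            ≈⟨ FPS.distribʳ Rest A (⊝ (A ⊛ B)) ⟩
      A ⊛ Rest ⊕ (⊝ (A ⊛ B)) ⊛ Rest                     ≈⟨ FPS.+-congˡ {A ⊛ Rest} (FPS.sym (⊝-distribˡ-⊛ (A ⊛ B) Rest)) ⟩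
      A ⊛ Rest ⊕ ⊝ ((A ⊛ B) ⊛ Rest)
        ≈⟨ FPS.+-cong (FPS.trans (FPS.*-congʳ {Rest} (αz/ψ^ k)) (term≋ k k n))
                      (FPS.-‿cong (FPS.trans (FPS.*-congʳ {Rest} (αz/ψ^⊛αz²/ψ^ k t)) (term≋ (k ℕ.+ t) (k ℕ.+ (t ℕ.+ t)) n))) ⟩
      term k k n ⊕ ⊝ term (k ℕ.+ t) (k ℕ.+ (t ℕ.+ t)) n
        ≈⟨ FPS.reflexive (≡.cong₂ (λ J J′ → term k J n ⊕ ⊝ term (k ℕ.+ t) J′ n) (≡.sym (ℕ.+-identityʳ k)) (≡.sym (ℕ.+-assoc k t t))) ⟩
      term k (k ℕ.+ 0) n ⊕ ⊝ term (k ℕ.+ t) (k ℕ.+ t ℕ.+ t) n ∎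
      where
      A = αz/ψ ^ˢ k
      B = αz²/ψ ^ˢ t
      Rest = 1/[1+xz] ⊛ (αz² ⊛ φ ^ˢ n)

    H⊛kernel-coeff : ∀ k t n → (H k t ⊛ kernel n) (suc n) ≈ coefficient k 0 n - coefficient (k ℕ.+ t) t n
    H⊛kernel-coeff k t n = trans (H⊛kernel k t n (suc n)) (+-cong (term-coeff k 0) (-‿cong (term-coeff (k ℕ.+ t) t)))
      where
      term-coeff : ∀ K T → term K (K ℕ.+ T) n (suc n) ≈ coefficient K T n
      term-coeff K T = const-⊛ (α ^ suc K) (X ^ˢ suc (suc (K ℕ.+ T)) ⊛ W K n) (suc n)

  module LeftHandSide
    (M : FPS) (M-eq : M ≋ 𝟙 ⊕ const (x + y) ⊛ (X ⊛ M) ⊕ const α ⊛ (X ^ˢ 2 ⊛ (M ⊛ M)))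
    (1/[1-yz] : FPS) (1-yz⊛1/[1-yz] : (𝟙 ⊕ ⊝ (const y ⊛ X)) ⊛ 1/[1-yz] ≋ 𝟙)
    (1/[1+xzM] : FPS) (1+xzM⊛1/[1+xzM] : (𝟙 ⊕ const x ⊛ (X ⊛ M)) ⊛ 1/[1+xzM] ≋ 𝟙)
    (1/[1-αz²M²] : FPS) (1-αz²M²⊛1/[1-αz²M²] : (𝟙 ⊕ ⊝ (const α ⊛ (X ^ˢ 2 ⊛ (M ⊛ M)))) ⊛ 1/[1-αz²M²] ≋ 𝟙)
    (1/ψ : FPS) (ψ⊛1/ψ : ψ ⊛ 1/ψ ≋ 𝟙)
    (1/[1+xz] : FPS) (1+xz⊛1/[1+xz] : 1+xz ⊛ 1/[1+xz] ≋ 𝟙)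
    (1/[1-αz²] : FPS) (1-αz²⊛1/[1-αz²] : 1-αz² ⊛ 1/[1-αz²] ≋ 𝟙) where

    open Coefficients 1/ψ ψ⊛1/ψ 1/[1+xz] 1+xz⊛1/[1+xz] 1/[1-αz²] 1-αz²⊛1/[1-αz²]

    lhs : ℕ → ℕ → FPS
    lhs k t = (((const α ⊛ X) ⊛ 1/[1-yz]) ^ˢ k
               ⊛ ((𝟙 ⊕ ⊝ (((const α ⊛ (X ^ˢ 2 ⊛ M)) ⊛ 1/[1-yz]) ^ˢ t)) ⊛ 1/[1+xzM]))
              ⊛ ((const α ⊛ (X ⊛ M) ^ˢ 2) ⊛ 1/[1-αz²M²])

    u : FPS
    u = X ⊛ M

    u≋XΦu : u ≋ X ⊛ Φ u
    u≋XΦu = FPS.*-congˡ {X} (FPS.trans M-eq (FPS.+-congˡ {𝟙 ⊕ const (x + y) ⊛ u} (FPS.*-congˡ {const α}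
              (⊛-solve 2 (λ z m → (z · (z · ⊛-Solver.id)) · (m · m) ⊜ (z · m) · (z · m)) FPS.refl X M))))

    open Inversion u u≋XΦu
    open Composition u u0

    -- u = z Φ(u) = z (ψ(u) + y u)
    X⊛ψ∘u≋u⊛1-yz : X ⊛ quadratic x α u ≋ u ⊛ (𝟙 ⊕ ⊝ (const y ⊛ X))
    X⊛ψ∘u≋u⊛1-yz = begin⟨ FPS.setoid ⟩
      X ⊛ quadratic x α u
        ≈⟨ FPS.trans (FPS.sym (FPS.+-identityʳ (X ⊛ quadratic x α u)))
                     (FPS.+-congˡ {X ⊛ quadratic x α u} (FPS.sym (FPS.-‿inverseʳ (X ⊛ (const y ⊛ u))))) ⟩
      X ⊛ quadratic x α u ⊕ (X ⊛ (const y ⊛ u) ⊕ ⊝ (X ⊛ (const y ⊛ u)))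
        ≈⟨ FPS.sym (FPS.+-assoc _ _ _) ⟩
      (X ⊛ quadratic x α u ⊕ X ⊛ (const y ⊛ u)) ⊕ ⊝ (X ⊛ (const y ⊛ u))
        ≈⟨ FPS.+-congʳ (FPS.trans (FPS.sym (FPS.distribˡ X (quadratic x α u) (const y ⊛ u)))
                                  (FPS.trans (FPS.*-congˡ {X} (FPS.sym (Φ≋quadratic⊕yV u))) (FPS.sym u≋XΦu))) ⟩
      u ⊕ ⊝ (X ⊛ (const y ⊛ u))
        ≈⟨ FPS.+-cong (FPS.sym (FPS.*-identityʳ u))
             (FPS.trans (FPS.-‿cong (⊛-solve 3 (λ z c v → z · (c · v) ⊜ v · (c · z)) FPS.refl X (const y) u)) (⊝-distribʳ-⊛ u (const y ⊛ X))) ⟩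
      u ⊛ 𝟙 ⊕ u ⊛ ⊝ (const y ⊛ X)              ≈⟨ FPS.sym (FPS.distribˡ u 𝟙 (⊝ (const y ⊛ X))) ⟩
      u ⊛ (𝟙 ⊕ ⊝ (const y ⊛ X))               ∎

    X⊛1/[1-yz]≋u⊛1/ψ∘u : X ⊛ 1/[1-yz] ≋ u ⊛ comp 1/ψ
    X⊛1/[1-yz]≋u⊛1/ψ∘u = begin⟨ FPS.setoid ⟩
      X ⊛ 1/[1-yz]                                       ≈⟨ FPS.sym (FPS.*-identityʳ _) ⟩
      (X ⊛ 1/[1-yz]) ⊛ 𝟙                                 ≈⟨ FPS.*-congˡ {X ⊛ 1/[1-yz]} (FPS.sym ψ∘u⊛1/ψ∘u) ⟩
      (X ⊛ 1/[1-yz]) ⊛ (quadratic x α u ⊛ comp 1/ψ)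
        ≈⟨ ⊛-solve 4 (λ z i f c → (z · i) · (f · c) ⊜ ((z · f) · i) · c) FPS.refl X 1/[1-yz] (quadratic x α u) (comp 1/ψ) ⟩
      ((X ⊛ quadratic x α u) ⊛ 1/[1-yz]) ⊛ comp 1/ψ      ≈⟨ FPS.*-congʳ {comp 1/ψ} (FPS.*-congʳ {1/[1-yz]} X⊛ψ∘u≋u⊛1-yz) ⟩
      ((u ⊛ (𝟙 ⊕ ⊝ (const y ⊛ X))) ⊛ 1/[1-yz]) ⊛ comp 1/ψ ≈⟨ FPS.*-congʳ {comp 1/ψ} (cancel-inverseʳ _ 1/[1-yz] u 1-yz⊛1/[1-yz]) ⟩
      u ⊛ comp 1/ψ                                       ∎
      where
      ψ∘u⊛1/ψ∘u : quadratic x α u ⊛ comp 1/ψ ≋ 𝟙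
      ψ∘u⊛1/ψ∘u = FPS.trans (FPS.*-congʳ {comp 1/ψ} (FPS.sym (FPS.trans (comp-quadratic x α X) (quadratic-cong comp-X))))
                            (comp-inverse ψ 1/ψ ψ⊛1/ψ)
        where
        quadratic-cong : ∀ {V W} → V ≋ W → quadratic x α V ≋ quadratic x α W
        quadratic-cong V≋W = FPS.+-cong (FPS.+-congˡ {𝟙} (FPS.*-congˡ {const x} V≋W)) (FPS.*-congˡ {const α} (FPS.*-cong V≋W V≋W))

    comp-αz/ψ : (const α ⊛ X) ⊛ 1/[1-yz] ≋ comp αz/ψ
    comp-αz/ψ = begin⟨ FPS.setoid ⟩
      (const α ⊛ X) ⊛ 1/[1-yz]     ≈⟨ FPS.*-assoc (const α) X 1/[1-yz] ⟩
      const α ⊛ (X ⊛ 1/[1-yz])     ≈⟨ FPS.*-congˡ {const α} X⊛1/[1-yz]≋u⊛1/ψ∘u ⟩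
      const α ⊛ (u ⊛ comp 1/ψ)     ≈⟨ FPS.sym (FPS.trans (comp-⊛ (const α) (X ⊛ 1/ψ)) (FPS.*-cong (comp-const α)
                                        (FPS.trans (comp-⊛ X 1/ψ) (FPS.*-congʳ {comp 1/ψ} comp-X)))) ⟩
      comp αz/ψ                    ∎

    comp-αz²/ψ : (const α ⊛ (X ^ˢ 2 ⊛ M)) ⊛ 1/[1-yz] ≋ comp αz²/ψ
    comp-αz²/ψ = begin⟨ FPS.setoid ⟩
      (const α ⊛ (X ^ˢ 2 ⊛ M)) ⊛ 1/[1-yz]
        ≈⟨ ⊛-solve 4 (λ a z m i → (a · ((z · (z · ⊛-Solver.id)) · m)) · i ⊜ a · ((z · m) · (z · i))) FPS.refl (const α) X M 1/[1-yz] ⟩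
      const α ⊛ (u ⊛ (X ⊛ 1/[1-yz]))        ≈⟨ FPS.*-congˡ {const α} (FPS.*-congˡ {u} X⊛1/[1-yz]≋u⊛1/ψ∘u) ⟩
      const α ⊛ (u ⊛ (u ⊛ comp 1/ψ))
        ≈⟨ FPS.sym (FPS.trans (comp-⊛ (const α) (X ⊛ (X ⊛ 1/ψ))) (FPS.*-cong (comp-const α)
             (FPS.trans (comp-⊛ X (X ⊛ 1/ψ)) (FPS.*-cong comp-X (FPS.trans (comp-⊛ X 1/ψ) (FPS.*-congʳ {comp 1/ψ} comp-X)))))) ⟩
      comp αz²/ψ                             ∎

    comp-1/[1+xz] : 1/[1+xzM] ≋ comp 1/[1+xz]
    comp-1/[1+xz] = inverse-unique (𝟙 ⊕ const x ⊛ u) 1/[1+xzM] (comp 1/[1+xz]) 1+xzM⊛1/[1+xzM]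
      (FPS.trans (FPS.*-congʳ {comp 1/[1+xz]} (FPS.sym comp-1+xz)) (comp-inverse 1+xz 1/[1+xz] 1+xz⊛1/[1+xz]))
      where
      comp-1+xz : comp 1+xz ≋ 𝟙 ⊕ const x ⊛ u
      comp-1+xz = FPS.trans (comp-⊕ 𝟙 (const x ⊛ X)) (FPS.+-cong comp-𝟙 (FPS.trans (comp-⊛ (const x) X) (FPS.*-cong (comp-const x) comp-X)))

    comp-αz² : const α ⊛ (X ⊛ M) ^ˢ 2 ≋ comp αz²
    comp-αz² = FPS.sym (FPS.trans (comp-⊛ (const α) (X ^ˢ 2)) (FPS.*-cong (comp-const α) (FPS.trans (comp-^ X 2) (^ˢ-congˡ 2 comp-X))))

    comp-1/[1-αz²] : 1/[1-αz²M²] ≋ comp 1/[1-αz²]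
    comp-1/[1-αz²] = inverse-unique (𝟙 ⊕ ⊝ (const α ⊛ u ^ˢ 2)) 1/[1-αz²M²] (comp 1/[1-αz²])
      (FPS.trans (FPS.*-congʳ {1/[1-αz²M²]} (FPS.+-congˡ {𝟙} (FPS.-‿cong (FPS.*-congˡ {const α} X²M²≋u²)))) 1-αz²M²⊛1/[1-αz²M²])
      (FPS.trans (FPS.*-congʳ {comp 1/[1-αz²]} (FPS.sym comp-1-αz²)) (comp-inverse 1-αz² 1/[1-αz²] 1-αz²⊛1/[1-αz²]))
      where
      X²M²≋u² : u ^ˢ 2 ≋ X ^ˢ 2 ⊛ (M ⊛ M)
      X²M²≋u² = ⊛-solve 2 (λ z m → (z · m) · ((z · m) · ⊛-Solver.id) ⊜ (z · (z · ⊛-Solver.id)) · (m · m)) FPS.refl X M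
      comp-1-αz² : comp 1-αz² ≋ 𝟙 ⊕ ⊝ (const α ⊛ u ^ˢ 2)
      comp-1-αz² = FPS.trans (comp-⊕ 𝟙 (⊝ αz²)) (FPS.+-cong comp-𝟙 (FPS.trans (comp-⊝ αz²) (FPS.-‿cong (FPS.sym comp-αz²))))

    lhs≋comp-H : ∀ k t → lhs k t ≋ comp (H k t)
    lhs≋comp-H k t = FPS.sym (begin⟨ FPS.setoid ⟩
      comp ((αz/ψ ^ˢ k ⊛ ((𝟙 ⊕ ⊝ (αz²/ψ ^ˢ t)) ⊛ 1/[1+xz])) ⊛ (αz² ⊛ 1/[1-αz²]))
        ≈⟨ FPS.trans (comp-⊛ (A ⊛ ((𝟙 ⊕ ⊝ B) ⊛ 1/[1+xz])) (αz² ⊛ 1/[1-αz²]))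
             (FPS.*-cong (FPS.trans (comp-⊛ A ((𝟙 ⊕ ⊝ B) ⊛ 1/[1+xz])) (FPS.*-congˡ {comp A} (FPS.trans (comp-⊛ (𝟙 ⊕ ⊝ B) 1/[1+xz])
                            (FPS.*-congʳ {comp 1/[1+xz]} (FPS.trans (comp-⊕ 𝟙 (⊝ B)) (FPS.+-cong comp-𝟙 (comp-⊝ B)))))))
                         (comp-⊛ αz² 1/[1-αz²])) ⟩
      (comp (αz/ψ ^ˢ k) ⊛ ((𝟙 ⊕ ⊝ comp (αz²/ψ ^ˢ t)) ⊛ comp 1/[1+xz])) ⊛ (comp αz² ⊛ comp 1/[1-αz²])
        ≈⟨ FPS.*-cong (FPS.*-cong (FPS.trans (comp-^ αz/ψ k) (^ˢ-congˡ k (FPS.sym comp-αz/ψ)))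
                                  (FPS.*-cong (FPS.+-congˡ {𝟙} (FPS.-‿cong (FPS.trans (comp-^ αz²/ψ t) (^ˢ-congˡ t (FPS.sym comp-αz²/ψ)))))
                                              (FPS.sym comp-1/[1+xz])))
                      (FPS.*-cong (FPS.sym comp-αz²) (FPS.sym comp-1/[1-αz²])) ⟩
      lhs k t ∎)
      where
      A = αz/ψ ^ˢ k
      B = αz²/ψ ^ˢ t

    lhs-coeff : ∀ k t n → lhs k t (suc n) ≈ coefficient k 0 n - coefficient (k ℕ.+ t) t n
    lhs-coeff k t n = trans (lhs≋comp-H k t (suc n)) (trans (lagrange-inversion (H k t) n) (H⊛kernel-coeff k t n))

-- Poly = ℕ → ℕ → ℕ → ℚ is ℚ[[x]][[y]][[α]], read with the outermost variable first.
module ℚ⟦α⟧     = PowerSeries ℚ.+-*-commutativeRing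
module ℚ⟦y,α⟧   = PowerSeries ℚ⟦α⟧.FPS-commutativeRing
module ℚ⟦x,y,α⟧ = PowerSeries ℚ⟦y,α⟧.FPS-commutativeRing
module Poly⟦z⟧  = PowerSeries ℚ⟦x,y,α⟧.FPS-commutativeRing
module Σℚ = FiniteSums ℚ.+-*-commutativeRing
module ΣPoly = FiniteSums ℚ⟦x,y,α⟧.FPS-commutativeRing

open Poly⟦z⟧ using (_≋_; _⊕_; _⊛_; ⊝_; 𝟙; X; const; _^ˢ_)

sumTo≡Σ : ∀ n g → sumTo n g ≡ Σℚ.Σ n g
sumTo≡Σ zero    g = ≡.refl
sumTo≡Σ (suc n) g = ≡.cong (ℚ._+ g (suc n)) (sumTo≡Σ n g)

Σ-coeff : ∀ n (F : ℕ → Poly) a b c → ℚ⟦x,y,α⟧.Σˢ n F a b c ≡ Σℚ.Σ n (λ i → F i a b c)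
Σ-coeff n F a b c = ≡.trans (ℚ⟦x,y,α⟧.Σˢ-coeff n F a b c)
  (≡.trans (ℚ⟦y,α⟧.Σˢ-coeff n (λ i → F i a) b c) (ℚ⟦α⟧.Σˢ-coeff n (λ i → F i a b) c))

sumP-coeff : ∀ n (F : ℕ → Poly) a b c → sumP n F a b c ≡ Σℚ.Σ n (λ i → F i a b c)
sumP-coeff zero    F a b c = ≡.refl
sumP-coeff (suc n) F a b c = ≡.cong (ℚ._+ F (suc n) a b c) (sumP-coeff n F a b c)

*P-coeff : ∀ p q a b c → (p *P q) a b c ≡ (p ℚ⟦x,y,α⟧.⊛ q) a b c
*P-coeff p q a b c = ≡.trans (sumTo≡Σ a _) (≡.sym (≡.trans (ℚ⟦y,α⟧.Σˢ-coeff a _ b c) (≡.trans (ℚ⟦α⟧.Σˢ-coeff a _ c)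
  (Σℚ.Σ-cong a (λ i → ≡.trans (ℚ⟦α⟧.Σˢ-coeff b _ c) (≡.sym (≡.trans (sumTo≡Σ b _) (Σℚ.Σ-cong b (λ j → sumTo≡Σ c _)))))))))

*S-coeff : ∀ A B n a b c → (A *S B) n a b c ≡ (A ⊛ B) n a b c
*S-coeff A B n a b c = ≡.trans (sumP-coeff n _ a b c)
  (≡.trans (Σℚ.Σ-cong n (λ k → *P-coeff (A k) (B (n ∸ k)) a b c)) (≡.sym (Σ-coeff n _ a b c)))

1P≋𝟙 : 1P ℚ⟦x,y,α⟧.≋ ℚ⟦x,y,α⟧.𝟙
1P≋𝟙 zero    zero    zero    = ≡.refl
1P≋𝟙 zero    zero    (suc c) = ≡.refl
1P≋𝟙 zero    (suc b) c       = ≡.refl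
1P≋𝟙 (suc a) b       c       = ≡.refl

1S≋𝟙 : 1S ≋ 𝟙
1S≋𝟙 zero    = 1P≋𝟙
1S≋𝟙 (suc n) _ _ _ = ≡.refl

zS≋X : zS ≋ X
zS≋X zero          _ _ _ = ≡.refl
zS≋X (suc zero)    = 1P≋𝟙
zS≋X (suc (suc n)) _ _ _ = ≡.refl

⟦⟧≋const : ∀ p → ⟦ p ⟧ ≋ const p
⟦⟧≋const p zero    _ _ _ = ≡.refl
⟦⟧≋const p (suc n) _ _ _ = ≡.refl

*S≋⊛ : ∀ {A A′ B B′} → A ≋ A′ → B ≋ B′ → (A *S B) ≋ A′ ⊛ B′
*S≋⊛ {A} {A′} {B} {B′} A≋ B≋ n a b c = ≡.trans (*S-coeff A B n a b c) (Poly⟦z⟧.⊛-cong A≋ B≋ n a b c)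

+S≋⊕ : ∀ {A A′ B B′} → A ≋ A′ → B ≋ B′ → (A +S B) ≋ A′ ⊕ B′
+S≋⊕ A≋ B≋ n a b c = ≡.cong₂ ℚ._+_ (A≋ n a b c) (B≋ n a b c)

-S≋⊝ : ∀ {A A′ B B′} → A ≋ A′ → B ≋ B′ → (A -S B) ≋ A′ ⊕ ⊝ B′
-S≋⊝ A≋ B≋ n a b c = ≡.cong₂ ℚ._+_ (A≋ n a b c) (≡.cong ℚ.-_ (B≋ n a b c))

^S≋^ˢ : ∀ {A A′} k → A ≋ A′ → (A ^S k) ≋ A′ ^ˢ k
^S≋^ˢ zero    A≋ = 1S≋𝟙
^S≋^ˢ (suc k) A≋ = *S≋⊛ A≋ (^S≋^ˢ k A≋)

≋-refl : ∀ {A} → A ≋ A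
≋-refl _ _ _ _ = ≡.refl

nth-invPrefix : ∀ A n k → k ≤ n → nth (invPrefix A n) k ≡ inv A (n ∸ k)
nth-invPrefix A zero    zero    z≤n       = ≡.refl
nth-invPrefix A (suc n) zero    z≤n       = ≡.refl
nth-invPrefix A (suc n) (suc k) (s≤s k≤n) = nth-invPrefix A n k k≤n

⊛-inv : ∀ A → A 0 ℚ⟦x,y,α⟧.≋ ℚ⟦x,y,α⟧.𝟙 → A ⊛ inv A ≋ 𝟙
⊛-inv A A0≋1 = Poly⟦z⟧.recurrence⇒inverse A (inv A) A0≋1 1P≋𝟙 inv-suc
  where
  inv-suc : ∀ n a b c → inv A (suc n) a b c ≡ ℚ.- ℚ⟦x,y,α⟧.Σˢ n (λ k → A (suc k) ℚ⟦x,y,α⟧.⊛ inv A (n ∸ k)) a b c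
  inv-suc n a b c = ≡.cong ℚ.-_ (≡.trans (sumP-coeff n _ a b c) (≡.trans (Σℚ.Σ-cong≤ n (λ k k≤n →
    ≡.trans (≡.cong (λ q → (A (suc k) *P q) a b c) (nth-invPrefix A n k k≤n)) (*P-coeff (A (suc k)) (inv A (n ∸ k)) a b c)))
    (≡.sym (Σ-coeff n _ a b c))))

⊛-inv′ : ∀ A {A′} → A ≋ A′ → A′ 0 ℚ⟦x,y,α⟧.≋ ℚ⟦x,y,α⟧.𝟙 → A′ ⊛ inv A ≋ 𝟙
⊛-inv′ A {A′} A≋A′ A′0≋1 = Poly⟦z⟧.FPS.trans (Poly⟦z⟧.⊛-cong {g = inv A} (Poly⟦z⟧.FPS.sym A≋A′) ≋-refl)
                                              (⊛-inv A (λ a b c → ≡.trans (A≋A′ 0 a b c) (A′0≋1 a b c)))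

open Motzkin ℚ⟦x,y,α⟧.FPS-commutativeRing xP yP αP public using (monomial; binomials; summand; expanded-term)
open Motzkin ℚ⟦x,y,α⟧.FPS-commutativeRing xP yP αP using (ψ; 1+xz; module Coefficients; module LeftHandSide)
open Lagrange ℚ⟦x,y,α⟧.FPS-commutativeRing (xP ℚ⟦x,y,α⟧.⊕ yP) αP using (αz²; 1-αz²)
open Poly⟦z⟧ using (head-𝟙⊕; head-𝟙⊕⊝; head-⊛ˡ; head-⊛ʳ; X⊛-zero)

private
  ℚ⟦x,y,α⟧-refl : ∀ {p} → p ℚ⟦x,y,α⟧.≋ p
  ℚ⟦x,y,α⟧-refl _ _ _ = ≡.refl

ψ⊛inv : ψ ⊛ inv ψ ≋ 𝟙
ψ⊛inv = ⊛-inv′ ψ (≋-refl {ψ})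
  (ℚ⟦x,y,α⟧.FPS.trans (ℚ⟦x,y,α⟧.FPS.+-congˡ {(𝟙 ⊕ const xP ⊛ X) 0} (head-⊛ʳ (const αP) (X ⊛ X) (X⊛-zero X)))
    (ℚ⟦x,y,α⟧.FPS.trans (ℚ⟦x,y,α⟧.FPS.+-identityʳ ((𝟙 ⊕ const xP ⊛ X) 0))
      (head-𝟙⊕ (const xP ⊛ X) (head-⊛ʳ (const xP) X ℚ⟦x,y,α⟧-refl))))

1+xz⊛inv : 1+xz ⊛ inv 1+xz ≋ 𝟙
1+xz⊛inv = ⊛-inv′ 1+xz (≋-refl {1+xz}) (head-𝟙⊕ (const xP ⊛ X) (head-⊛ʳ (const xP) X ℚ⟦x,y,α⟧-refl))

1-αz²⊛inv : 1-αz² ⊛ inv 1-αz² ≋ 𝟙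
1-αz²⊛inv = ⊛-inv′ 1-αz² (≋-refl {1-αz²}) (head-𝟙⊕⊝ αz² (head-⊛ʳ (const αP) (X ^ˢ 2) (X⊛-zero (X ^ˢ 1))))

module _ (M : Series) (isM : IsMotzkin M) where

  M-eq : M ≋ 𝟙 ⊕ const (xP ℚ⟦x,y,α⟧.⊕ yP) ⊛ (X ⊛ M) ⊕ const αP ⊛ (X ^ˢ 2 ⊛ (M ⊛ M))
  M-eq = Poly⟦z⟧.FPS.trans (λ n a b c → isM n a b c)
    (Poly⟦z⟧.FPS.trans (+S≋⊕ 1S≋𝟙 (+S≋⊕ (*S≋⊛ (⟦⟧≋const (xP +P yP)) (*S≋⊛ zS≋X (≋-refl {M})))
                                           (*S≋⊛ (⟦⟧≋const αP) (*S≋⊛ (^S≋^ˢ 2 zS≋X) (*S≋⊛ (≋-refl {M}) (≋-refl {M}))))))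
                       (Poly⟦z⟧.FPS.sym (Poly⟦z⟧.FPS.+-assoc 𝟙 (const (xP ℚ⟦x,y,α⟧.⊕ yP) ⊛ (X ⊛ M)) (const αP ⊛ (X ^ˢ 2 ⊛ (M ⊛ M))))))

  1-yz 1+xzM 1-αz²M² : Series
  1-yz    = 1S -S (⟦ yP ⟧ *S zS)
  1+xzM   = 1S +S (⟦ xP ⟧ *S (zS *S M))
  1-αz²M² = 1S -S (⟦ αP ⟧ *S ((zS ^S 2) *S (M *S M)))

  1-yz⊛inv : (𝟙 ⊕ ⊝ (const yP ⊛ X)) ⊛ inv 1-yz ≋ 𝟙
  1-yz⊛inv = ⊛-inv′ 1-yz (-S≋⊝ 1S≋𝟙 (*S≋⊛ (⟦⟧≋const yP) zS≋X))
               (head-𝟙⊕⊝ (const yP ⊛ X) (head-⊛ʳ (const yP) X ℚ⟦x,y,α⟧-refl))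

  1+xzM⊛inv : (𝟙 ⊕ const xP ⊛ (X ⊛ M)) ⊛ inv 1+xzM ≋ 𝟙
  1+xzM⊛inv = ⊛-inv′ 1+xzM (+S≋⊕ 1S≋𝟙 (*S≋⊛ (⟦⟧≋const xP) (*S≋⊛ zS≋X (≋-refl {M}))))
                (head-𝟙⊕ (const xP ⊛ (X ⊛ M)) (head-⊛ʳ (const xP) (X ⊛ M) (X⊛-zero M)))

  1-αz²M²⊛inv : (𝟙 ⊕ ⊝ (const αP ⊛ (X ^ˢ 2 ⊛ (M ⊛ M)))) ⊛ inv 1-αz²M² ≋ 𝟙
  1-αz²M²⊛inv = ⊛-inv′ 1-αz²M² (-S≋⊝ 1S≋𝟙 (*S≋⊛ (⟦⟧≋const αP) (*S≋⊛ (^S≋^ˢ 2 zS≋X) (*S≋⊛ (≋-refl {M}) (≋-refl {M})))))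
                  (head-𝟙⊕⊝ (const αP ⊛ (X ^ˢ 2 ⊛ (M ⊛ M)))
                    (head-⊛ʳ (const αP) (X ^ˢ 2 ⊛ (M ⊛ M)) (head-⊛ˡ (X ^ˢ 2) (M ⊛ M) (X⊛-zero (X ^ˢ 1)))))

  open LeftHandSide M M-eq (inv 1-yz) 1-yz⊛inv (inv 1+xzM) 1+xzM⊛inv (inv 1-αz²M²) 1-αz²M²⊛inv
                           (inv ψ) ψ⊛inv (inv 1+xz) 1+xz⊛inv (inv 1-αz²) 1-αz²⊛inv public

  lhsSeries≋lhs : ∀ f t → lhsSeries M f t ≋ lhs (f ∸ t) t
  lhsSeries≋lhs f t = *S≋⊛ (*S≋⊛ (^S≋^ˢ (f ∸ t) αz/[1-yz]) (*S≋⊛ (-S≋⊝ 1S≋𝟙 (^S≋^ˢ t αz²M/[1-yz])) (≋-refl {inv 1+xzM})))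
                                                  (*S≋⊛ (*S≋⊛ (⟦⟧≋const αP) (^S≋^ˢ 2 (*S≋⊛ zS≋X (≋-refl {M})))) (≋-refl {inv 1-αz²M²}))
    where
    αz/[1-yz] : (⟦ αP ⟧ *S zS) *S inv 1-yz ≋ (const αP ⊛ X) ⊛ inv 1-yz
    αz/[1-yz] = *S≋⊛ (*S≋⊛ (⟦⟧≋const αP) zS≋X) (≋-refl {inv 1-yz})
    αz²M/[1-yz] : (⟦ αP ⟧ *S ((zS ^S 2) *S M)) *S inv 1-yz ≋ (const αP ⊛ (X ^ˢ 2 ⊛ M)) ⊛ inv 1-yz
    αz²M/[1-yz] = *S≋⊛ (*S≋⊛ (⟦⟧≋const αP) (*S≋⊛ (^S≋^ˢ 2 zS≋X) (≋-refl {M}))) (≋-refl {inv 1-yz})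

open Coefficients (inv ψ) ψ⊛inv (inv 1+xz) 1+xz⊛inv (inv 1-αz²) 1-αz²⊛inv public

xP≋X : xP ℚ⟦x,y,α⟧.≋ ℚ⟦x,y,α⟧.X
xP≋X zero          _       _       = ≡.refl
xP≋X (suc zero)    zero    zero    = ≡.refl
xP≋X (suc zero)    zero    (suc c) = ≡.refl
xP≋X (suc zero)    (suc b) _       = ≡.refl
xP≋X (suc (suc a)) _       _       = ≡.refl

yP≋const-X : yP ℚ⟦x,y,α⟧.≋ ℚ⟦x,y,α⟧.const ℚ⟦y,α⟧.X
yP≋const-X zero    zero          _       = ≡.refl
yP≋const-X zero    (suc zero)    zero    = ≡.refl
yP≋const-X zero    (suc zero)    (suc c) = ≡.refl
yP≋const-X zero    (suc (suc b)) _       = ≡.refl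
yP≋const-X (suc a) _             _       = ≡.refl

αP≋const-const-X : αP ℚ⟦x,y,α⟧.≋ ℚ⟦x,y,α⟧.const (ℚ⟦y,α⟧.const ℚ⟦α⟧.X)
αP≋const-const-X zero    zero    zero          = ≡.refl
αP≋const-const-X zero    zero    (suc zero)    = ≡.refl
αP≋const-const-X zero    zero    (suc (suc c)) = ≡.refl
αP≋const-const-X zero    (suc b) _             = ≡.refl
αP≋const-const-X (suc a) _       _             = ≡.refl

x^y^α^ : ℕ → ℕ → ℕ → Poly
x^y^α^ a b e = xP ℚ⟦x,y,α⟧.^ˢ a ℚ⟦x,y,α⟧.⊛ (yP ℚ⟦x,y,α⟧.^ˢ b ℚ⟦x,y,α⟧.⊛ αP ℚ⟦x,y,α⟧.^ˢ e)

x^y^α^≋ : ∀ a b e → x^y^α^ a b e ℚ⟦x,y,α⟧.≋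
  ℚ⟦x,y,α⟧.X ℚ⟦x,y,α⟧.^ˢ a ℚ⟦x,y,α⟧.⊛ ℚ⟦x,y,α⟧.const (ℚ⟦y,α⟧.X ℚ⟦y,α⟧.^ˢ b ℚ⟦y,α⟧.⊛ ℚ⟦y,α⟧.const (ℚ⟦α⟧.X ℚ⟦α⟧.^ˢ e))
x^y^α^≋ a b e = ℚ⟦x,y,α⟧.FPS.*-cong (ℚ⟦x,y,α⟧.^ˢ-congˡ a xP≋X)
  (ℚ⟦x,y,α⟧.FPS.trans (ℚ⟦x,y,α⟧.FPS.*-cong
     (ℚ⟦x,y,α⟧.FPS.trans (ℚ⟦x,y,α⟧.^ˢ-congˡ b yP≋const-X) (ℚ⟦x,y,α⟧.const-^ ℚ⟦y,α⟧.X b))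
     (ℚ⟦x,y,α⟧.FPS.trans (ℚ⟦x,y,α⟧.^ˢ-congˡ e αP≋const-const-X)
        (ℚ⟦x,y,α⟧.FPS.trans (ℚ⟦x,y,α⟧.const-^ _ e) (ℚ⟦x,y,α⟧.const-cong (ℚ⟦y,α⟧.const-^ ℚ⟦α⟧.X e)))))
   (ℚ⟦x,y,α⟧.const-* _ _))

monomial-coeff : ∀ q a b e c d E → monomial q a b e c d E ≡ q Σℚ.× x^y^α^ a b e c d E
monomial-coeff q a b e c d E =
  ≡.trans (ℚ⟦x,y,α⟧.×ˢ-coeff q _ c d E) (≡.trans (ℚ⟦y,α⟧.×ˢ-coeff q _ d E) (ℚ⟦α⟧.×ˢ-coeff q _ E))

monomial-coeff-≡ : ∀ q a b e → monomial q a b e a b e ≡ q Σℚ.× 1ℚ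
monomial-coeff-≡ q a b e = ≡.trans (monomial-coeff q a b e a b e) (≡.cong (q Σℚ.×_)
  (≡.trans (x^y^α^≋ a b e a b e) (≡.trans (ℚ⟦x,y,α⟧.X^⊛const-≡ a _ b e) (≡.trans (ℚ⟦y,α⟧.X^⊛const-≡ b _ e)
  (≡.trans (ℚ⟦α⟧.FPS.sym (ℚ⟦α⟧.FPS.*-identityʳ (ℚ⟦α⟧.X ℚ⟦α⟧.^ˢ e)) e) (ℚ⟦α⟧.X^⊛const-≡ e 1ℚ))))))

monomial-coeff-≢ : ∀ q a b e c d E → ¬ (a ≡ c ∧ b ≡ d ∧ e ≡ E) → monomial q a b e c d E ≡ 0ℚ
monomial-coeff-≢ q a b e c d E ≢ = ≡.trans (monomial-coeff q a b e c d E)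
  (≡.trans (≡.cong (q Σℚ.×_) (≡.trans (x^y^α^≋ a b e c d E) (vanish (a ℕ.≟ c) (b ℕ.≟ d)))) (Σℚ.×-zeroʳ q))
  where
  S₂ = ℚ⟦y,α⟧.X ℚ⟦y,α⟧.^ˢ b ℚ⟦y,α⟧.⊛ ℚ⟦y,α⟧.const (ℚ⟦α⟧.X ℚ⟦α⟧.^ˢ e)
  vanish : Dec (a ≡ c) → Dec (b ≡ d) → (ℚ⟦x,y,α⟧.X ℚ⟦x,y,α⟧.^ˢ a ℚ⟦x,y,α⟧.⊛ ℚ⟦x,y,α⟧.const S₂) c d E ≡ 0ℚ
  vanish (no a≢c) _ = ℚ⟦x,y,α⟧.X^⊛const-≢ a S₂ c a≢c d E
  vanish (yes ≡.refl) (no b≢d) = ≡.trans (ℚ⟦x,y,α⟧.X^⊛const-≡ a S₂ d E) (ℚ⟦y,α⟧.X^⊛const-≢ b _ d b≢d E)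
  vanish (yes ≡.refl) (yes ≡.refl) = ≡.trans (ℚ⟦x,y,α⟧.X^⊛const-≡ a S₂ b E) (≡.trans (ℚ⟦y,α⟧.X^⊛const-≡ b _ E)
    (≡.trans (ℚ⟦α⟧.FPS.sym (ℚ⟦α⟧.FPS.*-identityʳ (ℚ⟦α⟧.X ℚ⟦α⟧.^ˢ e)) E)
             (ℚ⟦α⟧.X^⊛const-≢ e 1ℚ E (λ e≡E → ≢ (≡.refl , ≡.refl , e≡E)))))

nCk*k!*[n∸k]!≡n! : ∀ {n k} → k ≤ n → (n C k) ℕ.* (k ! ℕ.* (n ∸ k) !) ≡ n !
nCk*k!*[n∸k]!≡n! {n} {k} k≤n =
  ≡.trans (≡.cong (ℕ._* (k ! ℕ.* (n ∸ k) !)) (nCk≡n!/k![n-k]! k≤n)) (m/n*n≡m {{k ℕ.!* (n ∸ k) !≢0}} (k![n∸k]!∣n! k≤n))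

binomials*factorials : ∀ n d c e T → d ≤ n →
  ((n C d) ℕ.* (((e ℕ.+ suc (c ℕ.+ (e ℕ.+ T))) C e) ℕ.* ((c ℕ.+ (e ℕ.+ T)) C c)))
    ℕ.* (suc (c ℕ.+ (e ℕ.+ T)) ℕ.* (c ! ℕ.* (d ! ℕ.* ((n ∸ d) ! ℕ.* (e ! ℕ.* (e ℕ.+ T) !)))))
  ≡ n ! ℕ.* (e ℕ.+ suc (c ℕ.+ (e ℕ.+ T))) !
binomials*factorials n d c e T d≤n = begin
  ((n C d) ℕ.* ((m C e) ℕ.* (r C c))) ℕ.* (suc r ℕ.* (c ! ℕ.* (d ! ℕ.* ((n ∸ d) ! ℕ.* (e ! ℕ.* (e ℕ.+ T) !)))))
    ≡⟨ regroup (n C d) (m C e) (r C c) r (c !) (d !) ((n ∸ d) !) (e !) ((e ℕ.+ T) !) ⟩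
  ((n C d) ℕ.* (d ! ℕ.* (n ∸ d) !)) ℕ.* ((m C e) ℕ.* (e ! ℕ.* (suc r ℕ.* ((r C c) ℕ.* (c ! ℕ.* (e ℕ.+ T) !)))))
    ≡⟨ ≡.cong₂ (λ a b → a ℕ.* ((m C e) ℕ.* (e ! ℕ.* (suc r ℕ.* b)))) (nCk*k!*[n∸k]!≡n! d≤n) r!≡ ⟩
  n ! ℕ.* ((m C e) ℕ.* (e ! ℕ.* (suc r ℕ.* r !)))
    ≡⟨ ≡.cong (λ k → n ! ℕ.* ((m C e) ℕ.* (e ! ℕ.* k !))) (≡.sym (ℕ.m+n∸m≡n e (suc r))) ⟩
  n ! ℕ.* ((m C e) ℕ.* (e ! ℕ.* (m ∸ e) !))
    ≡⟨ ≡.cong (n ! ℕ.*_) (nCk*k!*[n∸k]!≡n! (ℕ.m≤m+n e (suc r))) ⟩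
  n ! ℕ.* m ! ∎
  where
  open ≡.≡-Reasoning
  r = c ℕ.+ (e ℕ.+ T)
  m = e ℕ.+ suc r
  r!≡ : (r C c) ℕ.* (c ! ℕ.* (e ℕ.+ T) !) ≡ r !
  r!≡ = ≡.trans (≡.cong (λ k → (r C c) ℕ.* (c ! ℕ.* k !)) (≡.sym (ℕ.m+n∸m≡n c (e ℕ.+ T)))) (nCk*k!*[n∸k]!≡n! (ℕ.m≤m+n c (e ℕ.+ T)))
  regroup : ∀ X Y Z r c d nd e g → (X ℕ.* (Y ℕ.* Z)) ℕ.* (suc r ℕ.* (c ℕ.* (d ℕ.* (nd ℕ.* (e ℕ.* g)))))
                                 ≡ (X ℕ.* (d ℕ.* nd)) ℕ.* (Y ℕ.* (e ℕ.* (suc r ℕ.* (Z ℕ.* (c ℕ.* g)))))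
  regroup = solve-∀

toℚ : ℕ → ℚ
toℚ n = + n ℚ./ 1

private
  toℚᵘ-toℚ : ∀ n → ℚ.toℚᵘ (toℚ n) ℚᵘ.≃ ℚᵘ.mkℚᵘ (+ n) 0
  toℚᵘ-toℚ n = ℚ.toℚᵘ-fromℚᵘ (ℚᵘ.mkℚᵘ (+ n) 0)

toℚ-* : ∀ a b → toℚ (a ℕ.* b) ≡ toℚ a ℚ.* toℚ b
toℚ-* a b = ℚ.toℚᵘ-injective (ℚᵘ.≃-trans (toℚᵘ-toℚ (a ℕ.* b)) (ℚᵘ.≃-sym (ℚᵘ.≃-trans (ℚ.toℚᵘ-homo-* (toℚ a) (toℚ b))
  (ℚᵘ.≃-trans (ℚᵘ.*-cong (toℚᵘ-toℚ a) (toℚᵘ-toℚ b)) (ℚᵘ.*≡* (≡.cong (ℤ._* + 1) (≡.sym (ℤ.pos-* a b))))))))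

1/n*n≡1 : ∀ n .{{_ : ℕ.NonZero n}} → (+ 1 ℚ./ n) ℚ.* toℚ n ≡ 1ℚ
1/n*n≡1 (suc n) = ℚ.toℚᵘ-injective (ℚᵘ.≃-trans (ℚ.toℚᵘ-homo-* (+ 1 ℚ./ suc n) (toℚ (suc n)))
  (ℚᵘ.≃-trans (ℚᵘ.*-cong (ℚ.toℚᵘ-fromℚᵘ (ℚᵘ.mkℚᵘ (+ 1) n)) (toℚᵘ-toℚ (suc n)))
              (ℚᵘ.*≡* eq)))
  where
  eq : (+ 1 ℤ.* + suc n) ℤ.* + 1 ≡ + 1 ℤ.* + (suc n ℕ.* 1)
  eq = ≡.trans (ℤ.*-identityʳ _) (≡.trans (ℤ.*-identityˡ _) (≡.sym (≡.trans (ℤ.*-identityˡ _) (≡.cong +_ (ℕ.*-identityʳ (suc n))))))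

×1ℚ≡toℚ : ∀ n → n Σℚ.× 1ℚ ≡ toℚ n
×1ℚ≡toℚ zero    = ≡.refl
×1ℚ≡toℚ (suc n) = ≡.trans (≡.cong (1ℚ ℚ.+_) (×1ℚ≡toℚ n)) (ℚ.toℚᵘ-injective (ℚᵘ.≃-trans (ℚ.toℚᵘ-homo-+ 1ℚ (toℚ n))
  (ℚᵘ.≃-trans (ℚᵘ.+-cong (toℚᵘ-toℚ 1) (toℚᵘ-toℚ n)) (ℚᵘ.≃-sym (ℚᵘ.≃-trans (toℚᵘ-toℚ (suc n))
    (ℚᵘ.*≡* eq))))))
  where
  eq : + suc n ℤ.* + 1 ≡ (+ 1 ℤ.* + 1 ℤ.+ + n ℤ.* + 1) ℤ.* + 1
  eq = ≡.trans (ℤ.*-identityʳ _) (≡.sym (≡.trans (ℤ.*-identityʳ _) (≡.cong (ℤ._+_ (+ 1)) (ℤ.*-identityʳ (+ n)))))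

toℚ-quotient : ∀ q d a w → q ℕ.* d ≡ a → w ℚ.* toℚ d ≡ 1ℚ → toℚ q ≡ toℚ a ℚ.* w
toℚ-quotient q d a w qd≡a wd≡1 = begin
  toℚ q                          ≡⟨ ℚ.*-identityʳ (toℚ q) ⟨
  toℚ q ℚ.* 1ℚ                   ≡⟨ ≡.cong (toℚ q ℚ.*_) wd≡1 ⟨
  toℚ q ℚ.* (w ℚ.* toℚ d)        ≡⟨ ≡.cong (toℚ q ℚ.*_) (ℚ.*-comm w (toℚ d)) ⟩
  toℚ q ℚ.* (toℚ d ℚ.* w)        ≡⟨ ℚ.*-assoc (toℚ q) (toℚ d) w ⟨
  (toℚ q ℚ.* toℚ d) ℚ.* w        ≡⟨ ≡.cong (ℚ._* w) (≡.trans (≡.sym (toℚ-* q d)) (≡.cong toℚ qd≡a)) ⟩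
  toℚ a ℚ.* w                    ∎
  where open ≡.≡-Reasoning

-- m! m′! / (r c! d! a! b! b′!), which is 0 as soon as a factorial in the denominator has a negative argument
factorialQuotient : ℤ → ℤ → ℤ → ℤ → ℤ → ℤ → ℤ → ℤ → ℚ
factorialQuotient m m′ r c d a b b′ =
  fact m ℚ.* fact m′ ℚ.* recip r ℚ.* invFact c ℚ.* invFact d ℚ.* invFact a ℚ.* invFact b ℚ.* invFact b′

factorialQuotient-cong : ∀ c d {m₁ m₂ m₁′ m₂′ r₁ r₂ a₁ a₂ b₁ b₂ b₁′ b₂′} →
  m₁ ≡ m₂ → m₁′ ≡ m₂′ → r₁ ≡ r₂ → a₁ ≡ a₂ → b₁ ≡ b₂ → b₁′ ≡ b₂′ →
  factorialQuotient m₁ m₁′ r₁ c d a₁ b₁ b₁′ ≡ factorialQuotient m₂ m₂′ r₂ c d a₂ b₂ b₂′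
factorialQuotient-cong c d ≡.refl ≡.refl ≡.refl ≡.refl ≡.refl ≡.refl = ≡.refl

factorialQuotient-vanishes : ∀ m m′ r c d a j b′ → factorialQuotient m m′ r c d a -[1+ j ] b′ ≡ 0ℚ
factorialQuotient-vanishes m m′ r c d a j b′ =
  ≡.trans (≡.cong (ℚ._* invFact b′) (ℚ.*-zeroʳ (fact m ℚ.* fact m′ ℚ.* recip r ℚ.* invFact c ℚ.* invFact d ℚ.* invFact a)))
          (ℚ.*-zeroˡ (invFact b′))

-- The coefficient of x^c y^d α^E in coefficient K T n when c + d + 2E + T = n + 1 + K
closedForm : ℕ → ℕ → ℕ → ℕ → ℕ → ℕ → ℚ
closedForm n K T c d E = factorialQuotient (+ n) (+ n ℤ.- + d ℤ.- + K) (+ suc n ℤ.- + d ℤ.- + E) (+ c) (+ d)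
                                           (+ n ℤ.- + d) (+ E ℤ.- + K ℤ.- + 1) (+ E ℤ.- + K ℤ.- + 1 ℤ.+ + T)

bracket≡closedForm : ∀ n k t c d E → bracket (suc n) (k ℕ.+ t) t c d E ≡ closedForm n k 0 c d E ℚ.- closedForm n (k ℕ.+ t) t c d E
bracket≡closedForm n k t c d E = ≡.cong₂ ℚ._-_
  (factorialQuotient-cong (+ c) (+ d) (pred-eq (+ n)) (first-eq (+ n) (+ d) (+ k) (+ t)) (≡.refl {x = R}) (pred-eq′ (+ n) (+ d))
                          (E-eq (+ E) (+ k) (+ t)) (≡.trans (E-eq (+ E) (+ k) (+ t)) (≡.sym (ℤ.+-identityʳ _))))
  (factorialQuotient-cong (+ c) (+ d) (pred-eq (+ n)) (second-eq (+ n) (+ d) (+ k) (+ t)) (≡.refl {x = R}) (pred-eq′ (+ n) (+ d))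
                          (≡.refl {x = + E ℤ.- + (k ℕ.+ t) ℤ.- + 1}) (E-eq′ (+ E) (+ k) (+ t)))
  where
  R = + suc n ℤ.- + d ℤ.- + E
  pred-eq : ∀ n → (+ 1 ℤ.+ n) ℤ.- + 1 ≡ n
  pred-eq = ℤ-Solver.solve-∀
  pred-eq′ : ∀ n d → (+ 1 ℤ.+ n) ℤ.- d ℤ.- + 1 ≡ n ℤ.- d
  pred-eq′ = ℤ-Solver.solve-∀
  first-eq : ∀ n d k t → (+ 1 ℤ.+ n) ℤ.- d ℤ.- (k ℤ.+ t) ℤ.+ t ℤ.- + 1 ≡ n ℤ.- d ℤ.- k
  first-eq = ℤ-Solver.solve-∀
  second-eq : ∀ n d k t → (+ 1 ℤ.+ n) ℤ.- d ℤ.- (k ℤ.+ t) ℤ.- + 1 ≡ n ℤ.- d ℤ.- (k ℤ.+ t)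
  second-eq = ℤ-Solver.solve-∀
  E-eq : ∀ E k t → E ℤ.- (k ℤ.+ t) ℤ.+ t ℤ.- + 1 ≡ E ℤ.- k ℤ.- + 1
  E-eq = ℤ-Solver.solve-∀
  E-eq′ : ∀ E k t → E ℤ.- (k ℤ.+ t) ℤ.+ t ℤ.- + 1 ≡ E ℤ.- (k ℤ.+ t) ℤ.- + 1 ℤ.+ t
  E-eq′ = ℤ-Solver.solve-∀

closedForm-vanishes : ∀ n K T c d E → E ≤ K → closedForm n K T c d E ≡ 0ℚ
closedForm-vanishes n K T c d E E≤K with K ∸ E | ℕ.m+[n∸m]≡n E≤K
... | j | ≡.refl = ≡.trans (≡.cong (λ b → factorialQuotient m m′ r (+ c) (+ d) a b (b ℤ.+ + T)) (negative (+ E) (+ j)))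
                           (factorialQuotient-vanishes m m′ r (+ c) (+ d) a j (ℤ.- (+ 1 ℤ.+ + j) ℤ.+ + T))
  where
  m = + n
  m′ = + n ℤ.- + d ℤ.- + (E ℕ.+ j)
  r = + suc n ℤ.- + d ℤ.- + E
  a = + n ℤ.- + d
  negative : ∀ E j → E ℤ.- (E ℤ.+ j) ℤ.- + 1 ≡ ℤ.- (+ 1 ℤ.+ j)
  negative = ℤ-Solver.solve-∀

inverse-factorials : ∀ r c d a b b′ →
  (recip (+ suc r) ℚ.* invFact (+ c) ℚ.* invFact (+ d) ℚ.* invFact (+ a) ℚ.* invFact (+ b) ℚ.* invFact (+ b′))
    ℚ.* toℚ (suc r ℕ.* (c ! ℕ.* (d ! ℕ.* (a ! ℕ.* (b ! ℕ.* b′ !))))) ≡ 1ℚ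
inverse-factorials r c d a b b′ = begin
  (R ℚ.* I c ℚ.* I d ℚ.* I a ℚ.* I b ℚ.* I b′) ℚ.* toℚ (suc r ℕ.* (c ! ℕ.* (d ! ℕ.* (a ! ℕ.* (b ! ℕ.* b′ !)))))
    ≡⟨ ≡.cong ((R ℚ.* I c ℚ.* I d ℚ.* I a ℚ.* I b ℚ.* I b′) ℚ.*_)
         (≡.trans (toℚ-* (suc r) (c ! ℕ.* (d ! ℕ.* (a ! ℕ.* (b ! ℕ.* b′ !))))) (≡.cong (toℚ (suc r) ℚ.*_)
         (≡.trans (toℚ-* (c !) (d ! ℕ.* (a ! ℕ.* (b ! ℕ.* b′ !))))
         (≡.cong (toℚ (c !) ℚ.*_) (≡.trans (toℚ-* (d !) (a ! ℕ.* (b ! ℕ.* b′ !))) (≡.cong (toℚ (d !) ℚ.*_) (≡.trans (toℚ-* (a !) (b ! ℕ.* b′ !))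
           (≡.cong (toℚ (a !) ℚ.*_) (toℚ-* (b !) (b′ !)))))))))) ⟩
  (R ℚ.* I c ℚ.* I d ℚ.* I a ℚ.* I b ℚ.* I b′) ℚ.* (F (suc r) ℚ.* (F (c !) ℚ.* (F (d !) ℚ.* (F (a !) ℚ.* (F (b !) ℚ.* F (b′ !))))))
    ≡⟨ *-Solver.solve 12 (λ r i₁ i₂ i₃ i₄ i₅ f f₁ f₂ f₃ f₄ f₅ →
         (((((r ∙ i₁) ∙ i₂) ∙ i₃) ∙ i₄) ∙ i₅) ∙ (f ∙ (f₁ ∙ (f₂ ∙ (f₃ ∙ (f₄ ∙ f₅)))))
         ⊜ (r ∙ f) ∙ ((i₁ ∙ f₁) ∙ ((i₂ ∙ f₂) ∙ ((i₃ ∙ f₃) ∙ ((i₄ ∙ f₄) ∙ (i₅ ∙ f₅))))))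
         ≡.refl R (I c) (I d) (I a) (I b) (I b′) (F (suc r)) (F (c !)) (F (d !)) (F (a !)) (F (b !)) (F (b′ !)) ⟩
  (R ℚ.* F (suc r)) ℚ.* ((I c ℚ.* F (c !)) ℚ.* ((I d ℚ.* F (d !)) ℚ.* ((I a ℚ.* F (a !)) ℚ.* ((I b ℚ.* F (b !)) ℚ.* (I b′ ℚ.* F (b′ !))))))
    ≡⟨ ≡.cong₂ ℚ._*_ (1/n*n≡1 (suc r)) (≡.cong₂ ℚ._*_ (1/n!*n!≡1 c) (≡.cong₂ ℚ._*_ (1/n!*n!≡1 d)
         (≡.cong₂ ℚ._*_ (1/n!*n!≡1 a) (≡.cong₂ ℚ._*_ (1/n!*n!≡1 b) (1/n!*n!≡1 b′))))) ⟩
  1ℚ ℚ.* (1ℚ ℚ.* (1ℚ ℚ.* (1ℚ ℚ.* (1ℚ ℚ.* 1ℚ))))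
    ≡⟨⟩
  1ℚ ∎
  where
  open ≡.≡-Reasoning
  open Algebra.Solver.CommutativeMonoid ℚ.*-1-commutativeMonoid using (_⊜_) renaming (_⊕_ to _∙_) 
  module *-Solver = Algebra.Solver.CommutativeMonoid ℚ.*-1-commutativeMonoid
  R = recip (+ suc r)
  I : ℕ → ℚ
  I n = invFact (+ n)
  F = toℚ
  1/n!*n!≡1 : ∀ n → I n ℚ.* F (n !) ≡ 1ℚ
  1/n!*n!≡1 n = 1/n*n≡1 (n !) {{n ℕ.!≢0}}

closedForm-binomials : ∀ n K T c d E N e →
  n ≡ suc (K ℕ.+ T) ℕ.+ N → E ≡ e ℕ.+ suc K → c ℕ.+ d ℕ.+ (e ℕ.+ e) ≡ N →
  closedForm n K T c d E ≡ toℚ ((n C d) ℕ.* (((e ℕ.+ suc (c ℕ.+ (e ℕ.+ T))) C e) ℕ.* ((c ℕ.+ (e ℕ.+ T)) C c)))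
closedForm-binomials ._ K T c d ._ ._ e ≡.refl ≡.refl ≡.refl = begin
  closedForm n K T c d E
    ≡⟨ factorialQuotient-cong (+ c) (+ d) (≡.refl {x = + n}) (m′-eq (+ K) (+ T) (+ c) (+ d) (+ e)) (r-eq (+ K) (+ T) (+ c) (+ d) (+ e))
                              (≡.trans (ℤ.m-n≡m⊖n n d) (ℤ.⊖-≥ d≤n)) (b-eq (+ K) (+ e)) (b′-eq (+ K) (+ e) (+ T)) ⟩
  factorialQuotient (+ n) (+ m) (+ suc r) (+ c) (+ d) (+ (n ∸ d)) (+ e) (+ (e ℕ.+ T))
    ≡⟨ *-Solver.solve 8 (λ f f′ r i₁ i₂ i₃ i₄ i₅ → ((((((f ∙ f′) ∙ r) ∙ i₁) ∙ i₂) ∙ i₃) ∙ i₄) ∙ i₅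
                                                  ⊜ (f ∙ f′) ∙ (((((r ∙ i₁) ∙ i₂) ∙ i₃) ∙ i₄) ∙ i₅))
         ≡.refl (fact (+ n)) (fact (+ m)) (recip (+ suc r)) (invFact (+ c)) (invFact (+ d)) (invFact (+ (n ∸ d))) (invFact (+ e)) (invFact (+ (e ℕ.+ T))) ⟩
  (toℚ (n !) ℚ.* toℚ (m !)) ℚ.* w
    ≡⟨ ≡.cong (ℚ._* w) (toℚ-* (n !) (m !)) ⟨
  toℚ (n ! ℕ.* m !) ℚ.* w
    ≡⟨ toℚ-quotient ((n C d) ℕ.* ((m C e) ℕ.* (r C c))) (suc r ℕ.* (c ! ℕ.* (d ! ℕ.* ((n ∸ d) ! ℕ.* (e ! ℕ.* (e ℕ.+ T) !)))))
                    (n ! ℕ.* m !) w (binomials*factorials n d c e T d≤n) (inverse-factorials r c d (n ∸ d) e (e ℕ.+ T)) ⟨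
  toℚ ((n C d) ℕ.* ((m C e) ℕ.* (r C c))) ∎
  where
  open ≡.≡-Reasoning
  open Algebra.Solver.CommutativeMonoid ℚ.*-1-commutativeMonoid using (_⊜_) renaming (_⊕_ to _∙_)
  module *-Solver = Algebra.Solver.CommutativeMonoid ℚ.*-1-commutativeMonoid
  n = suc (K ℕ.+ T) ℕ.+ (c ℕ.+ d ℕ.+ (e ℕ.+ e))
  E = e ℕ.+ suc K
  r = c ℕ.+ (e ℕ.+ T)
  m = e ℕ.+ suc r
  w = recip (+ suc r) ℚ.* invFact (+ c) ℚ.* invFact (+ d) ℚ.* invFact (+ (n ∸ d)) ℚ.* invFact (+ e) ℚ.* invFact (+ (e ℕ.+ T))
  d≤n : d ≤ n
  d≤n = ℕ.≤-trans (ℕ.≤-trans (ℕ.m≤n+m d c) (ℕ.m≤m+n (c ℕ.+ d) (e ℕ.+ e))) (ℕ.m≤n+m _ (suc (K ℕ.+ T)))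
  m′-eq : ∀ K T c d e → (+ 1 ℤ.+ (K ℤ.+ T)) ℤ.+ (c ℤ.+ d ℤ.+ (e ℤ.+ e)) ℤ.- d ℤ.- K ≡ e ℤ.+ (+ 1 ℤ.+ (c ℤ.+ (e ℤ.+ T)))
  m′-eq = ℤ-Solver.solve-∀
  r-eq : ∀ K T c d e → (+ 1 ℤ.+ ((+ 1 ℤ.+ (K ℤ.+ T)) ℤ.+ (c ℤ.+ d ℤ.+ (e ℤ.+ e)))) ℤ.- d ℤ.- (e ℤ.+ (+ 1 ℤ.+ K))
                       ≡ + 1 ℤ.+ (c ℤ.+ (e ℤ.+ T))
  r-eq = ℤ-Solver.solve-∀
  b-eq : ∀ K e → (e ℤ.+ (+ 1 ℤ.+ K)) ℤ.- K ℤ.- + 1 ≡ e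
  b-eq = ℤ-Solver.solve-∀
  b′-eq : ∀ K e T → (e ℤ.+ (+ 1 ℤ.+ K)) ℤ.- K ℤ.- + 1 ℤ.+ T ≡ e ℤ.+ T
  b′-eq = ℤ-Solver.solve-∀

when-coeff : ∀ {p} {P : Set p} (P? : Dec P) (f : Poly) a b c → ΣPoly.when P? f a b c ≡ Σℚ.when P? (f a b c)
when-coeff (yes _) f a b c = ≡.refl
when-coeff (no  _) f a b c = ≡.refl

summand-miss : ∀ n T N K d′ e′ c d E → d′ ≤ N → (d′ ≡ d → e′ ℕ.+ suc K ≡ E → c ℕ.+ d ℕ.+ (e′ ℕ.+ e′) ≢ N) →
               summand n T N K d′ e′ c d E ≡ 0ℚ
summand-miss n T N K d′ e′ c d E d′≤N ≢N = ≡.trans (when-coeff (e′ ℕ.+ e′ ℕ.≤? N ∸ d′) _ c d E)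
  (Σℚ.when-zero (e′ ℕ.+ e′ ℕ.≤? N ∸ d′) (λ 2e′≤ →
    monomial-coeff-≢ (binomials n T N d′ e′) (N ∸ d′ ∸ (e′ ℕ.+ e′)) d′ (e′ ℕ.+ suc K) c d E
    (λ { (j≡c , ≡.refl , e≡E) → ≢N ≡.refl e≡E (row 2e′≤ j≡c) })))
  where
  row : e′ ℕ.+ e′ ≤ N ∸ d′ → N ∸ d′ ∸ (e′ ℕ.+ e′) ≡ c → c ℕ.+ d′ ℕ.+ (e′ ℕ.+ e′) ≡ N
  row 2e′≤ ≡.refl = ≡.trans (≡.cong (ℕ._+ (e′ ℕ.+ e′)) (ℕ.+-comm (N ∸ d′ ∸ (e′ ℕ.+ e′)) d′))
    (≡.trans (ℕ.+-assoc d′ _ (e′ ℕ.+ e′)) (≡.trans (≡.cong (d′ ℕ.+_) (ℕ.m∸n+n≡m 2e′≤)) (ℕ.m+[n∸m]≡n d′≤N)))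

Σ-expanded-miss : ∀ n T N K c d E → (∀ e → e ℕ.+ suc K ≡ E → c ℕ.+ d ℕ.+ (e ℕ.+ e) ≢ N) →
                  ΣPoly.Σ n (expanded-term n T N K) c d E ≡ 0ℚ
Σ-expanded-miss n T N K c d E ≢N = ≡.trans (Σ-coeff n _ c d E) (Σℚ.Σ-zero n _ (λ d′ _ →
  ≡.trans (when-coeff (d′ ℕ.≤? N) _ c d E) (Σℚ.when-zero (d′ ℕ.≤? N) (λ d′≤N →
    ≡.trans (Σ-coeff (suc (T ℕ.+ (N ∸ d′))) (summand n T N K d′) c d E) (Σℚ.Σ-zero (suc (T ℕ.+ (N ∸ d′))) _ (λ e′ _ →
      summand-miss n T N K d′ e′ c d E d′≤N (λ _ → ≢N e′)))))))

row∸d : ∀ c d e → c ℕ.+ d ℕ.+ (e ℕ.+ e) ∸ d ≡ c ℕ.+ (e ℕ.+ e)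
row∸d c d e = ≡.trans (≡.cong (_∸ d) (shape c d (e ℕ.+ e))) (ℕ.m+n∸n≡m (c ℕ.+ (e ℕ.+ e)) d)
  where
  shape : ∀ c d e → c ℕ.+ d ℕ.+ e ≡ c ℕ.+ e ℕ.+ d
  shape = solve-∀

binomials-on-row : ∀ n T c d e → binomials n T (c ℕ.+ d ℕ.+ (e ℕ.+ e)) d e
                                 ≡ (n C d) ℕ.* (((e ℕ.+ suc (c ℕ.+ (e ℕ.+ T))) C e) ℕ.* ((c ℕ.+ (e ℕ.+ T)) C c))
binomials-on-row n T c d e = begin
  binomials n T (c ℕ.+ d ℕ.+ (e ℕ.+ e)) d e
    ≡⟨ ≡.cong (λ I → (n C d) ℕ.* ((suc (T ℕ.+ I) C e) ℕ.* ((suc (T ℕ.+ I) ∸ e ∸ 1) C (I ∸ (e ℕ.+ e))))) (row∸d c d e) ⟩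
  (n C d) ℕ.* ((suc (T ℕ.+ (c ℕ.+ (e ℕ.+ e))) C e) ℕ.* ((suc (T ℕ.+ (c ℕ.+ (e ℕ.+ e))) ∸ e ∸ 1) C (c ℕ.+ (e ℕ.+ e) ∸ (e ℕ.+ e))))
    ≡⟨ ≡.cong (λ k → (n C d) ℕ.* ((k C e) ℕ.* ((k ∸ e ∸ 1) C (c ℕ.+ (e ℕ.+ e) ∸ (e ℕ.+ e))))) (shape T c e) ⟩
  (n C d) ℕ.* ((m C e) ℕ.* ((m ∸ e ∸ 1) C (c ℕ.+ (e ℕ.+ e) ∸ (e ℕ.+ e))))
    ≡⟨ ≡.cong₂ (λ a b → (n C d) ℕ.* ((m C e) ℕ.* (a C b))) (≡.cong (_∸ 1) (ℕ.m+n∸m≡n e (suc r))) (ℕ.m+n∸n≡m c (e ℕ.+ e)) ⟩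
  (n C d) ℕ.* ((m C e) ℕ.* (r C c)) ∎
  where
  open ≡.≡-Reasoning
  r = c ℕ.+ (e ℕ.+ T)
  m = e ℕ.+ suc r
  shape : ∀ T c e → suc (T ℕ.+ (c ℕ.+ (e ℕ.+ e))) ≡ e ℕ.+ suc (c ℕ.+ (e ℕ.+ T))
  shape = solve-∀

Σ-expanded-hit : ∀ n T N K c d e → c ℕ.+ d ℕ.+ (e ℕ.+ e) ≡ N → N ≤ n →
                 ΣPoly.Σ n (expanded-term n T N K) c d (e ℕ.+ suc K)
                 ≡ toℚ ((n C d) ℕ.* (((e ℕ.+ suc (c ℕ.+ (e ℕ.+ T))) C e) ℕ.* ((c ℕ.+ (e ℕ.+ T)) C c)))
Σ-expanded-hit n T ._ K c d e ≡.refl N≤n = begin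
  ΣPoly.Σ n (expanded-term n T N K) c d E
    ≡⟨ Σ-coeff n _ c d E ⟩
  Σℚ.Σ n (λ d′ → expanded-term n T N K d′ c d E)
    ≡⟨ Σℚ.Σ-single n d _ (ℕ.≤-trans d≤N N≤n) (λ d′ _ d′≢d → ≡.trans (when-coeff (d′ ℕ.≤? N) _ c d E)
         (Σℚ.when-zero (d′ ℕ.≤? N) (λ d′≤N → ≡.trans (Σ-coeff (suc (T ℕ.+ (N ∸ d′))) (summand n T N K d′) c d E)
           (Σℚ.Σ-zero (suc (T ℕ.+ (N ∸ d′))) _ (λ e′ _ →
           summand-miss n T N K d′ e′ c d E d′≤N (λ d′≡d _ _ → d′≢d d′≡d)))))) ⟩
  expanded-term n T N K d c d E
    ≡⟨ ≡.trans (when-coeff (d ℕ.≤? N) _ c d E) (Σℚ.when-yes (d ℕ.≤? N) d≤N) ⟩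
  ΣPoly.Σ m (summand n T N K d) c d E
    ≡⟨ Σ-coeff m _ c d E ⟩
  Σℚ.Σ m (λ e′ → summand n T N K d e′ c d E)
    ≡⟨ Σℚ.Σ-single m e _ e≤m (λ e′ _ e′≢e → summand-miss n T N K d e′ c d E d≤N
         (λ _ e′≡ _ → e′≢e (ℕ.+-cancelʳ-≡ (suc K) e′ e e′≡))) ⟩
  summand n T N K d e c d E
    ≡⟨ ≡.trans (when-coeff (e ℕ.+ e ℕ.≤? N ∸ d) _ c d E) (Σℚ.when-yes (e ℕ.+ e ℕ.≤? N ∸ d) 2e≤I) ⟩
  monomial (binomials n T N d e) (I ∸ (e ℕ.+ e)) d E c d E
    ≡⟨ ≡.cong (λ j → monomial (binomials n T N d e) j d E c d E) j≡c ⟩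
  monomial (binomials n T N d e) c d E c d E
    ≡⟨ ≡.trans (monomial-coeff-≡ (binomials n T N d e) c d E) (×1ℚ≡toℚ (binomials n T N d e)) ⟩
  toℚ (binomials n T N d e)
    ≡⟨ ≡.cong toℚ (binomials-on-row n T c d e) ⟩
  toℚ ((n C d) ℕ.* (((e ℕ.+ suc (c ℕ.+ (e ℕ.+ T))) C e) ℕ.* ((c ℕ.+ (e ℕ.+ T)) C c))) ∎
  where
  open ≡.≡-Reasoning
  N = c ℕ.+ d ℕ.+ (e ℕ.+ e)
  E = e ℕ.+ suc K
  I = N ∸ d
  m = suc (T ℕ.+ I)
  I≡ : I ≡ c ℕ.+ (e ℕ.+ e)
  I≡ = row∸d c d e
  j≡c : I ∸ (e ℕ.+ e) ≡ c
  j≡c = ≡.trans (≡.cong (_∸ (e ℕ.+ e)) I≡) (ℕ.m+n∸n≡m c (e ℕ.+ e))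
  d≤N : d ≤ N
  d≤N = ℕ.≤-trans (ℕ.m≤n+m d c) (ℕ.m≤m+n (c ℕ.+ d) (e ℕ.+ e))
  2e≤I : e ℕ.+ e ≤ I
  2e≤I = ≡.subst (e ℕ.+ e ≤_) (≡.sym I≡) (ℕ.m≤n+m (e ℕ.+ e) c)
  e≤m : e ≤ m
  e≤m = ℕ.≤-trans (ℕ.m≤m+n e e) (ℕ.≤-trans 2e≤I (ℕ.≤-trans (ℕ.m≤n+m I T) (ℕ.n≤1+n _)))

data Row (K T : ℕ) : ℕ → Set where
  below : ∀ {n} → n < suc (K ℕ.+ T) → Row K T n
  row   : ∀ N → Row K T (suc (K ℕ.+ T) ℕ.+ N)

row? : ∀ K T n → Row K T n
row? K T n with n ℕ.<? suc (K ℕ.+ T)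
... | yes n< = below n<
... | no  n≮ = ≡.subst (Row K T) (ℕ.m+[n∸m]≡n (ℕ.≮⇒≥ n≮)) (row (n ∸ suc (K ℕ.+ T)))

-- coefficient-expansion at a point, with an explicit type so that checking its uses does not unfold the sum
coefficient-row : ∀ K T N c d E → coefficient K T (suc (K ℕ.+ T) ℕ.+ N) c d E
                  ≡ ΣPoly.Σ (suc (K ℕ.+ T) ℕ.+ N) (expanded-term (suc (K ℕ.+ T) ℕ.+ N) T N K) c d E
coefficient-row K T N c d E = coefficient-expansion K T N c d E

degree≡ : ∀ K T c d e E N → e ℕ.+ suc K ≡ E → c ℕ.+ d ℕ.+ (e ℕ.+ e) ≡ N →
          c ℕ.+ d ℕ.+ 2 ℕ.* E ℕ.+ T ≡ suc (suc (K ℕ.+ T) ℕ.+ N) ℕ.+ K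
degree≡ K T c d e _ _ ≡.refl ≡.refl = shape K T c d e
  where
  shape : ∀ K T c d e → c ℕ.+ d ℕ.+ 2 ℕ.* (e ℕ.+ suc K) ℕ.+ T ≡ suc (suc (K ℕ.+ T) ℕ.+ (c ℕ.+ d ℕ.+ (e ℕ.+ e))) ℕ.+ K
  shape = solve-∀

coefficient-mismatch : ∀ K T n c d E → c ℕ.+ d ℕ.+ 2 ℕ.* E ℕ.+ T ≢ suc n ℕ.+ K → coefficient K T n c d E ≡ 0ℚ
coefficient-mismatch K T n c d E = by-row (row? K T n)
  where
  by-row : ∀ {n} → Row K T n → c ℕ.+ d ℕ.+ 2 ℕ.* E ℕ.+ T ≢ suc n ℕ.+ K → coefficient K T n c d E ≡ 0ℚ
  by-row {n} (below n<) _ = coefficient-below K T n n< c d E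
  by-row (row N)    ≢ = ≡.trans (coefficient-row K T N c d E)
    (Σ-expanded-miss (suc (K ℕ.+ T) ℕ.+ N) T N K c d E (λ e e≡E row≡N → ≢ (degree≡ K T c d e E N e≡E row≡N)))

below⇒E≤K : ∀ K T n c d E → n < suc (K ℕ.+ T) → c ℕ.+ d ℕ.+ 2 ℕ.* E ℕ.+ T ≡ suc n ℕ.+ K → E ≤ K
below⇒E≤K K T n c d E (s≤s n≤) deg = ℕ.≮⇒≥ (λ K<E → ℕ.<-irrefl ≡.refl (ℕ.≤-<-trans (ℕ.≤-trans (high K<E) (ℕ.≤-reflexive deg)) low))
  where
  high : K < E → K ℕ.+ suc K ℕ.+ T < c ℕ.+ d ℕ.+ 2 ℕ.* E ℕ.+ T
  high K<E = ℕ.+-monoˡ-≤ T (ℕ.≤-trans (ℕ.+-mono-≤ K<E (ℕ.≤-trans K<E (ℕ.m≤m+n E 0))) (ℕ.m≤n+m (2 ℕ.* E) (c ℕ.+ d)))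
  low : suc n ℕ.+ K < suc (K ℕ.+ suc K ℕ.+ T)
  low = ≡.subst (suc n ℕ.+ K <_) (shape K T) (ℕ.+-monoˡ-< K (s≤s (s≤s n≤)))
    where
    shape : ∀ K T → suc (suc (K ℕ.+ T)) ℕ.+ K ≡ suc (K ℕ.+ suc K ℕ.+ T)
    shape = solve-∀

row-sum : ∀ K T c d e E N → e ℕ.+ suc K ≡ E → c ℕ.+ d ℕ.+ 2 ℕ.* E ℕ.+ T ≡ suc (suc (K ℕ.+ T) ℕ.+ N) ℕ.+ K →
          c ℕ.+ d ℕ.+ (e ℕ.+ e) ≡ N
row-sum K T c d e _ N ≡.refl deg = ℕ.+-cancelʳ-≡ (suc (suc (K ℕ.+ K ℕ.+ T))) (c ℕ.+ d ℕ.+ (e ℕ.+ e)) N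
  (≡.trans (left c d e K T) (≡.trans deg (right K T N)))
  where
  left : ∀ c d e K T → c ℕ.+ d ℕ.+ (e ℕ.+ e) ℕ.+ suc (suc (K ℕ.+ K ℕ.+ T)) ≡ c ℕ.+ d ℕ.+ 2 ℕ.* (e ℕ.+ suc K) ℕ.+ T
  left = solve-∀
  right : ∀ K T N → suc (suc (K ℕ.+ T) ℕ.+ N) ℕ.+ K ≡ N ℕ.+ suc (suc (K ℕ.+ K ℕ.+ T))
  right = solve-∀

coefficient-match : ∀ K T n c d E → c ℕ.+ d ℕ.+ 2 ℕ.* E ℕ.+ T ≡ suc n ℕ.+ K → coefficient K T n c d E ≡ closedForm n K T c d E
coefficient-match K T n c d E = by-row (row? K T n) (E ℕ.≤? K)
  where
  by-row : ∀ {n} → Row K T n → Dec (E ≤ K) → c ℕ.+ d ℕ.+ 2 ℕ.* E ℕ.+ T ≡ suc n ℕ.+ K →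
           coefficient K T n c d E ≡ closedForm n K T c d E
  by-row {n} (below n<) _ deg = ≡.trans (coefficient-below K T n n< c d E)
                                        (≡.sym (closedForm-vanishes n K T c d E (below⇒E≤K K T n c d E n< deg)))
  by-row (row N) (yes E≤K) _ = ≡.trans (coefficient-row K T N c d E)
    (≡.trans (Σ-expanded-miss (suc (K ℕ.+ T) ℕ.+ N) T N K c d E (λ e e+1+K≡E _ → ℕ.<-irrefl ≡.refl
               (ℕ.≤-trans (ℕ.≤-trans (ℕ.m≤n+m (suc K) e) (ℕ.≤-reflexive e+1+K≡E)) E≤K)))
             (≡.sym (closedForm-vanishes (suc (K ℕ.+ T) ℕ.+ N) K T c d E E≤K)))
  by-row (row N) (no E≰K) deg = begin
    coefficient K T n′ c d E                       ≡⟨ coefficient-row K T N c d E ⟩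
    ΣPoly.Σ n′ (expanded-term n′ T N K) c d E      ≡⟨ ≡.cong (ΣPoly.Σ n′ (expanded-term n′ T N K) c d) (≡.sym e+1+K≡E) ⟩
    ΣPoly.Σ n′ (expanded-term n′ T N K) c d (e ℕ.+ suc K)
      ≡⟨ Σ-expanded-hit n′ T N K c d e (row-sum K T c d e E N e+1+K≡E deg) (ℕ.m≤n+m N (suc (K ℕ.+ T))) ⟩
    toℚ ((n′ C d) ℕ.* (((e ℕ.+ suc (c ℕ.+ (e ℕ.+ T))) C e) ℕ.* ((c ℕ.+ (e ℕ.+ T)) C c)))
      ≡⟨ closedForm-binomials n′ K T c d E N e ≡.refl (≡.sym e+1+K≡E) (row-sum K T c d e E N e+1+K≡E deg) ⟨
    closedForm n′ K T c d E ∎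
    where
    open ≡.≡-Reasoning
    n′ = suc (K ℕ.+ T) ℕ.+ N
    e = E ∸ suc K
    e+1+K≡E : e ℕ.+ suc K ≡ E
    e+1+K≡E = ℕ.m∸n+n≡m (ℕ.≰⇒> E≰K)

rhsPoly-match : ∀ n f t c d e → c ℕ.+ d ℕ.+ 2 ℕ.* e ℕ.+ t ≡ n ℕ.+ f → rhsPoly n f t c d e ≡ bracket n f t c d e
rhsPoly-match n f t c d e deg with c ℕ.+ d ℕ.+ 2 ℕ.* e ℕ.+ t ℕ.≟ n ℕ.+ f
... | yes _   = ≡.refl
... | no  deg≢ = contradiction deg deg≢

rhsPoly-mismatch : ∀ n f t c d e → c ℕ.+ d ℕ.+ 2 ℕ.* e ℕ.+ t ≢ n ℕ.+ f → rhsPoly n f t c d e ≡ 0ℚ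
rhsPoly-mismatch n f t c d e deg≢ with c ℕ.+ d ℕ.+ 2 ℕ.* e ℕ.+ t ℕ.≟ n ℕ.+ f
... | yes deg = contradiction deg deg≢
... | no  _   = ≡.refl

coefficients≡rhsPoly : ∀ n k t c d e →
  coefficient k 0 n c d e ℚ.- coefficient (k ℕ.+ t) t n c d e ≡ rhsPoly (suc n) (k ℕ.+ t) t c d e
coefficients≡rhsPoly n k t c d e = by-degree (c ℕ.+ d ℕ.+ 2 ℕ.* e ℕ.+ t ℕ.≟ suc n ℕ.+ (k ℕ.+ t))
  where
  shift : c ℕ.+ d ℕ.+ 2 ℕ.* e ℕ.+ 0 ≡ suc n ℕ.+ k → c ℕ.+ d ℕ.+ 2 ℕ.* e ℕ.+ t ≡ suc n ℕ.+ (k ℕ.+ t)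
  shift deg = ≡.trans (≡.cong (ℕ._+ t) (≡.trans (≡.sym (ℕ.+-identityʳ _)) deg)) (ℕ.+-assoc (suc n) k t)
  unshift : c ℕ.+ d ℕ.+ 2 ℕ.* e ℕ.+ t ≡ suc n ℕ.+ (k ℕ.+ t) → c ℕ.+ d ℕ.+ 2 ℕ.* e ℕ.+ 0 ≡ suc n ℕ.+ k
  unshift deg = ℕ.+-cancelʳ-≡ t _ _ (≡.trans (≡.cong (ℕ._+ t) (ℕ.+-identityʳ _)) (≡.trans deg (≡.sym (ℕ.+-assoc (suc n) k t))))
  by-degree : Dec (c ℕ.+ d ℕ.+ 2 ℕ.* e ℕ.+ t ≡ suc n ℕ.+ (k ℕ.+ t)) →
              coefficient k 0 n c d e ℚ.- coefficient (k ℕ.+ t) t n c d e ≡ rhsPoly (suc n) (k ℕ.+ t) t c d e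
  by-degree (yes deg) = ≡.trans (≡.cong₂ ℚ._-_ (coefficient-match k 0 n c d e (unshift deg)) (coefficient-match (k ℕ.+ t) t n c d e deg))
                                (≡.sym (≡.trans (rhsPoly-match (suc n) (k ℕ.+ t) t c d e deg) (bracket≡closedForm n k t c d e)))
  by-degree (no deg≢) = ≡.trans (≡.cong₂ ℚ._-_ (coefficient-mismatch k 0 n c d e (deg≢ ∘ shift))
                                                (coefficient-mismatch (k ℕ.+ t) t n c d e deg≢))
                                (≡.sym (rhsPoly-mismatch (suc n) (k ℕ.+ t) t c d e deg≢))

lemma22 : (M : Series) → IsMotzkin M →
          (n f t : ℕ) → 1 ≤ n → 1 ≤ f → t ≤ f →
          ∀ c d e → coeff n (lhsSeries M f t) c d e ≡ rhsPoly n f t c d e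
lemma22 M isM (suc n) f t _ _ t≤f c d e = begin
  lhsSeries M f t (suc n) c d e                                   ≡⟨ lhsSeries≋lhs M isM f t (suc n) c d e ⟩
  lhs M isM k t (suc n) c d e                                     ≡⟨ lhs-coeff M isM k t n c d e ⟩
  coefficient k 0 n c d e ℚ.- coefficient (k ℕ.+ t) t n c d e     ≡⟨ coefficients≡rhsPoly n k t c d e ⟩
  rhsPoly (suc n) (k ℕ.+ t) t c d e                               ≡⟨ ≡.cong (λ f → rhsPoly (suc n) f t c d e) (ℕ.m∸n+n≡m t≤f) ⟩
  rhsPoly (suc n) f t c d e                                       ∎
  where
  open ≡.≡-Reasoning
  k = f ∸ t
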